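{- Let $A$ be a finite alphabet equipped with a total order $<$. Given an $\mathbb{N}$-rational series $s$ over $A^{*}$ (for instance, given by a finite $\mathbb{N}$-representation $(\lambda,\mu,\nu)$), it is decidable whether $s$ is the enumerating series of some abstract numeration system $(L,A,<)$, i.e. whether there exists an infinite language $L\subseteq A^{*}$ with $s=\mathsf{E}_L$.
   Context: The radix order $\prec$ on $A^{*}$ (strict version) is defined by $u\prec v$ if either $|u|<|v|$, or $|u|=|v|$, $u=wau'$, $v=wbv'$ with letters $a<b$. An abstract numeration system (ANS) is a triple $(L,A,<)$ where $L\subseteq A^{*}$ is an infinite language; every $n\in\mathbb{N}$ is represented by the $(n+1)$-th word of $L$ in the radix order, and for $w\in L$ the value $\mathrm{val}_L(w)$ is the integer $n$ whose representation is $w$ (i.e. the number of words of $L$ strictly smaller than $w$ in radix order). The enumerating series of the ANS is the $\mathbb{N}$-series $\mathsf{E}_L=\sum_{w\in L}(\mathrm{val}_L(w)+1)\,w$, i.e. the map $A^{*}\to\mathbb{N}$ sending $w\in L$ to $\mathrm{val}_L(w)+1$ and words outside $L$ to $0$. An $\mathbb{N}$-series $s:A^{*}\to\mathbb{N}$ is $\mathbb{N}$-rational (equivalently $\mathbb{N}$-recognisable) if there exist $n$, a monoid morphism $\mu:A^{*}\to\mathbb{N}^{n\times n}$, a row vector $\lambda\in\mathbb{N}^{1\times n}$ and a column vector $\nu\in\mathbb{N}^{n\times 1}$ with $s(w)=\lambda\mu(w)\nu$ for all $w\in A^{*}$. -}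

module Defs where

open import Data.Nat using (ℕ; zero; suc; _+_; _*_; _<ᵇ_; _≡ᵇ_)
open import Data.Bool using (Bool; true; false; _∧_; _∨_; if_then_else_)
open import Data.Fin using (Fin; toℕ)
open import Data.List using (List; []; _∷_; length; map; concatMap; filter; upTo; allFin)
open import Data.List.Membership.Propositional using (_∉_)
open import Data.Product using (Σ; _×_)
open import Relation.Binary.PropositionalEquality using (_≡_)
open import Relation.Nullary.Decidable using (Dec)
open import Data.Bool.Properties using (T?)
open import Data.Bool using (T)

-- Alphabet with k letters, totally ordered: Fin k with its natural order.
Word : ℕ → Set
Word k = List (Fin k)

-- lexicographic strict comparison, used for words of equal length:
-- u = w a u', v = w b v' with a < b
lexLt : ∀ {k} → Word k → Word k → Bool
lexLt []      _       = false
lexLt (_ ∷ _) []      = false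
lexLt (a ∷ u) (b ∷ v) = (toℕ a <ᵇ toℕ b) ∨ ((toℕ a ≡ᵇ toℕ b) ∧ lexLt u v)

radixLt : ∀ {k} → Word k → Word k → Bool
radixLt u v = (length u <ᵇ length v) ∨ ((length u ≡ᵇ length v) ∧ lexLt u v)

wordsOfLength : (k : ℕ) → ℕ → List (Word k)
wordsOfLength k zero    = [] ∷ []
wordsOfLength k (suc m) = concatMap (λ a → map (a ∷_) (wordsOfLength k m)) (allFin k)

wordsUpTo : (k : ℕ) → ℕ → List (Word k)
wordsUpTo k m = concatMap (wordsOfLength k) (upTo (suc m))

Language : ℕ → Set
Language k = Word k → Bool

-- val_L(w) = number of words of L strictly smaller than w in radix order
-- (all such words have length ≤ |w|, so they all occur in wordsUpTo k |w|)
val : ∀ {k} → Language k → Word k → ℕ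
val {k} L w = length (filter (λ u → T? (L u ∧ radixLt u w)) (wordsUpTo k (length w)))

enumSeries : ∀ {k} → Language k → Word k → ℕ
enumSeries L w = if L w then suc (val L w) else 0

Infinite : ∀ {k} → Language k → Set
Infinite {k} L = (ws : List (Word k)) → Σ (Word k) λ w → (L w ≡ true) × (w ∉ ws)

Matrix : ℕ → Set
Matrix n = Fin n → Fin n → ℕ

sumFin : ∀ {n} → (Fin n → ℕ) → ℕ
sumFin {zero}  f = 0
sumFin {suc n} f = f Fin.zero + sumFin (λ i → f (Fin.suc i))

identity : ∀ {n} → Matrix n
identity i j = if (toℕ i ≡ᵇ toℕ j) then 1 else 0

_·_ : ∀ {n} → Matrix n → Matrix n → Matrix n
(M · N) i j = sumFin (λ l → M i l * N l j)

record Rep (k n : ℕ) : Set where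
  field
    row : Fin n → ℕ
    mu  : Fin k → Matrix n
    col : Fin n → ℕ

muStar : ∀ {k n} → (Fin k → Matrix n) → Word k → Matrix n
muStar mu []      = identity
muStar mu (a ∷ w) = mu a · muStar mu w

series : ∀ {k n} → Rep k n → Word k → ℕ
series r w = sumFin (λ i → sumFin (λ j → Rep.row r i * muStar (Rep.mu r) w i j * Rep.col r j))

IsEnumeratingSeries : ∀ {k} → (Word k → ℕ) → Set
IsEnumeratingSeries {k} s = Σ (Language k) λ L → Infinite L × ((w : Word k) → s w ≡ enumSeries L w)

module Submission where

-- An enumerating series E_L is positive exactly on L, so the only candidate language is the
-- support Supp of s. Reading words from right to left, the zero pattern of μ(w)ν evolves
-- deterministically, so Supp is recognised by an automaton with 2 ^ n states. Supp is infinite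
-- iff some word y of length 2 ^ n has a prefix extension z with s(zy) ≠ 0 (pumping), and for
-- fixed y this is the non-vanishing of the ℤ-rational series z ↦ λμ(z)μ(y)ν. For w in Supp,
-- val(w) is the number of accepted words shorter than w plus the number of accepted words of
-- length |w| lexicographically below w; tensored with the automaton, these counters satisfy
-- linear recurrences in the prepended letter, so [w ∈ Supp](s(w) − 1 − val(w)) is again
-- ℤ-rational. Both questions are zero tests for ℤ-linear representations, decided by saturating
-- the span of the reachable vectors with fraction-free Gaussian elimination: the span is closed
-- under the letters once the work list empties, and its dimension is bounded.

open import Defs
open import Data.Bool using (true; false; _∧_; T; if_then_else_)
open import Data.Bool.Properties using (T?)
open import Data.List using (length)
open import Data.List.Properties using (filter-≐)
open import Data.Nat using (ℕ; suc)
open import Data.Product using (_×_; _,_)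
open import Function.Bundles using (_⇔_; mk⇔)
open import Relation.Binary.PropositionalEquality using (_≡_; refl; sym; trans; cong; cong₂; subst)
open import Relation.Nullary.Decidable using (Dec; _×-dec_)
import Relation.Nullary.Decidable as Dec

module Sums where

  open import Algebra.Core using (Op₂)
  open import Algebra.Structures using (IsCommutativeSemiring)
  open import Data.Bool using (Bool; true; false; _∧_) renaming (_≟_ to _≟ᵇ_)
  open import Data.Fin using (Fin; toℕ)
  open import Data.List using (List; []; _∷_; _++_; map; concatMap; allFin)
  open import Data.List.Properties using (map-tabulate)
  open import Data.List.Membership.Propositional using (_∈_)
  open import Data.List.Membership.Propositional.Properties using (∈-++⁺ˡ; ∈-++⁺ʳ; ∈-map⁺)
  open import Data.List.Relation.Unary.Any using (here; there)
  open import Data.Nat using (ℕ; zero; suc; _≡ᵇ_)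
  open import Data.Vec using (Vec; []; _∷_)
  open import Data.Vec.Properties using (≡-dec)
  open import Relation.Binary.PropositionalEquality
  open import Relation.Nullary using (Dec; does)

  allBoolVecs : (n : ℕ) → List (Vec Bool n)
  allBoolVecs zero    = [] ∷ []
  allBoolVecs (suc n) = map (false ∷_) (allBoolVecs n) ++ map (true ∷_) (allBoolVecs n)

  ∈-allBoolVecs : ∀ {n} (p : Vec Bool n) → p ∈ allBoolVecs n
  ∈-allBoolVecs []          = here refl
  ∈-allBoolVecs (false ∷ p) = ∈-++⁺ˡ (∈-map⁺ (false ∷_) (∈-allBoolVecs p))
  ∈-allBoolVecs {suc n} (true ∷ p) =
    ∈-++⁺ʳ (map (false ∷_) (allBoolVecs n)) (∈-map⁺ (true ∷_) (∈-allBoolVecs p))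

  _≟ᵛ_ : ∀ {n} (p q : Vec Bool n) → Dec (p ≡ q)
  _≟ᵛ_ = ≡-dec _≟ᵇ_

  module Sum {A : Set} {plus times : Op₂ A} {0# 1# : A}
             (isCommutativeSemiring : IsCommutativeSemiring _≡_ plus times 0# 1#) where

    open IsCommutativeSemiring isCommutativeSemiring
      using (+-assoc; +-comm; +-identityˡ; +-identityʳ; *-assoc; *-comm; *-identityˡ; distribˡ; zeroˡ; zeroʳ)

    private
      infixl 6 _+_
      infixl 7 _*_

      _+_ _*_ : Op₂ A
      _+_ = plus
      _*_ = times

    ∑ : ∀ {X : Set} → List X → (X → A) → A
    ∑ []       f = 0#
    ∑ (x ∷ xs) f = f x + ∑ xs f

    syntax ∑ xs (λ x → e) = ∑[ x ∈ xs ] e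

    ind : Bool → A
    ind true  = 1#
    ind false = 0#

    +-interchange : ∀ a b c d → (a + b) + (c + d) ≡ (a + c) + (b + d)
    +-interchange a b c d = begin
      (a + b) + (c + d)  ≡⟨ +-assoc a b (c + d) ⟩
      a + (b + (c + d))  ≡⟨ cong (a +_) (sym (+-assoc b c d)) ⟩
      a + ((b + c) + d)  ≡⟨ cong (λ x → a + (x + d)) (+-comm b c) ⟩
      a + ((c + b) + d)  ≡⟨ cong (a +_) (+-assoc c b d) ⟩
      a + (c + (b + d))  ≡⟨ sym (+-assoc a c (b + d)) ⟩
      (a + c) + (b + d)  ∎
      where open ≡-Reasoning

    *-left-comm : ∀ a b c → a * (b * c) ≡ b * (a * c)
    *-left-comm a b c = trans (sym (*-assoc a b c)) (trans (cong (_* c) (*-comm a b)) (*-assoc b a c))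

    ind-∧ : ∀ a b → ind (a ∧ b) ≡ ind a * ind b
    ind-∧ true  b = sym (*-identityˡ _)
    ind-∧ false b = sym (zeroˡ _)

    module _ {X : Set} where

      ∑-cong∈ : ∀ (xs : List X) {f g : X → A} → (∀ x → x ∈ xs → f x ≡ g x) → ∑ xs f ≡ ∑ xs g
      ∑-cong∈ []       e = refl
      ∑-cong∈ (x ∷ xs) e = cong₂ _+_ (e x (here refl)) (∑-cong∈ xs (λ y y∈ → e y (there y∈)))

      ∑-cong : ∀ (xs : List X) {f g : X → A} → (∀ x → f x ≡ g x) → ∑ xs f ≡ ∑ xs g
      ∑-cong xs e = ∑-cong∈ xs (λ x _ → e x)

      ∑-zero : ∀ (xs : List X) → ∑[ x ∈ xs ] 0# ≡ 0#
      ∑-zero []       = refl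
      ∑-zero (x ∷ xs) = trans (+-identityˡ _) (∑-zero xs)

      ∑-++ : ∀ (xs ys : List X) f → ∑ (xs ++ ys) f ≡ ∑ xs f + ∑ ys f
      ∑-++ []       ys f = sym (+-identityˡ _)
      ∑-++ (x ∷ xs) ys f = trans (cong (f x +_) (∑-++ xs ys f)) (sym (+-assoc _ _ _))

      ∑-distrib-+ : ∀ (xs : List X) f g → ∑[ x ∈ xs ] (f x + g x) ≡ ∑ xs f + ∑ xs g
      ∑-distrib-+ []       f g = sym (+-identityˡ _)
      ∑-distrib-+ (x ∷ xs) f g = trans (cong (f x + g x +_) (∑-distrib-+ xs f g)) (+-interchange _ _ _ _)

      ∑-*ˡ : ∀ (xs : List X) c f → ∑[ x ∈ xs ] (c * f x) ≡ c * ∑ xs f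
      ∑-*ˡ []       c f = sym (zeroʳ c)
      ∑-*ˡ (x ∷ xs) c f = trans (cong (c * f x +_) (∑-*ˡ xs c f)) (sym (distribˡ c _ _))

      ∑-*ʳ : ∀ (xs : List X) c f → ∑[ x ∈ xs ] (f x * c) ≡ ∑ xs f * c
      ∑-*ʳ xs c f = trans (∑-cong xs (λ x → *-comm (f x) c)) (trans (∑-*ˡ xs c f) (*-comm c _))

    ∑-map : ∀ {X Y : Set} (h : X → Y) (xs : List X) f → ∑ (map h xs) f ≡ ∑[ x ∈ xs ] f (h x)
    ∑-map h []       f = refl
    ∑-map h (x ∷ xs) f = cong (f (h x) +_) (∑-map h xs f)

    ∑-concatMap : ∀ {X Y : Set} (h : X → List Y) (xs : List X) f →
                  ∑ (concatMap h xs) f ≡ ∑[ x ∈ xs ] ∑ (h x) f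
    ∑-concatMap h []       f = refl
    ∑-concatMap h (x ∷ xs) f =
      trans (∑-++ (h x) (concatMap h xs) f) (cong (∑ (h x) f +_) (∑-concatMap h xs f))

    ∑-comm : ∀ {X Y : Set} (xs : List X) (ys : List Y) (f : X → Y → A) →
             ∑[ x ∈ xs ] ∑[ y ∈ ys ] f x y ≡ ∑[ y ∈ ys ] ∑[ x ∈ xs ] f x y
    ∑-comm []       ys f = sym (∑-zero ys)
    ∑-comm (x ∷ xs) ys f =
      trans (cong (∑ ys (f x) +_) (∑-comm xs ys f)) (sym (∑-distrib-+ ys (f x) _))

    [_≟_] : ∀ {n} → Vec Bool n → Vec Bool n → A
    [ p ≟ q ] = ind (does (p ≟ᵛ q))

    ∑-select : ∀ {n} (p : Vec Bool n) (g : Vec Bool n → A) →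
               ∑[ q ∈ allBoolVecs n ] ([ p ≟ q ] * g q) ≡ g p
    ∑-select []               g = trans (+-identityʳ _) (*-identityˡ (g []))
    ∑-select {suc n} (b ∷ p) g = begin
      ∑ (map (false ∷_) vs ++ map (true ∷_) vs) term
        ≡⟨ ∑-++ (map (false ∷_) vs) (map (true ∷_) vs) term ⟩
      ∑ (map (false ∷_) vs) term + ∑ (map (true ∷_) vs) term
        ≡⟨ cong₂ _+_ (∑-map (false ∷_) vs term) (∑-map (true ∷_) vs term) ⟩
      ∑[ q ∈ vs ] term (false ∷ q) + ∑[ q ∈ vs ] term (true ∷ q)
        ≡⟨ halves b ⟩
      g (b ∷ p) ∎
      where
      open ≡-Reasoning
      vs = allBoolVecs n
      term : Vec Bool (suc n) → A
      term q = [ b ∷ p ≟ q ] * g q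
      vanish : ∀ (h : Vec Bool n → A) → ∑[ q ∈ vs ] (0# * h q) ≡ 0#
      vanish h = trans (∑-cong vs (λ q → zeroˡ (h q))) (∑-zero vs)
      halves : ∀ b → ∑[ q ∈ vs ] ([ b ∷ p ≟ false ∷ q ] * g (false ∷ q))
                   + ∑[ q ∈ vs ] ([ b ∷ p ≟ true ∷ q ] * g (true ∷ q)) ≡ g (b ∷ p)
      halves false = trans (cong₂ _+_ (∑-select p (λ q → g (false ∷ q))) (vanish _)) (+-identityʳ _)
      halves true  = trans (cong₂ _+_ (vanish _) (∑-select p (λ q → g (true ∷ q)))) (+-identityˡ _)

    ∑-groupBy : ∀ {n} {X : Set} (xs : List X) (σ : X → Vec Bool n) (h : X → A) (g : Vec Bool n → A) →
                ∑[ u ∈ xs ] (h u * g (σ u)) ≡ ∑[ q ∈ allBoolVecs n ] (g q * ∑[ u ∈ xs ] (h u * [ σ u ≟ q ]))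
    ∑-groupBy {n} xs σ h g = begin
      ∑[ u ∈ xs ] (h u * g (σ u))
        ≡⟨ ∑-cong xs (λ u → cong (h u *_) (sym (∑-select (σ u) g))) ⟩
      ∑[ u ∈ xs ] (h u * ∑[ q ∈ vs ] ([ σ u ≟ q ] * g q))
        ≡⟨ ∑-cong xs (λ u → sym (∑-*ˡ vs (h u) _)) ⟩
      ∑[ u ∈ xs ] ∑[ q ∈ vs ] (h u * ([ σ u ≟ q ] * g q))
        ≡⟨ ∑-comm xs vs _ ⟩
      ∑[ q ∈ vs ] ∑[ u ∈ xs ] (h u * ([ σ u ≟ q ] * g q))
        ≡⟨ ∑-cong vs (λ q → ∑-cong xs (λ u → trans (sym (*-assoc (h u) _ (g q))) (*-comm _ (g q)))) ⟩
      ∑[ q ∈ vs ] ∑[ u ∈ xs ] (g q * (h u * [ σ u ≟ q ]))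
        ≡⟨ ∑-cong vs (λ q → ∑-*ˡ xs (g q) _) ⟩
      ∑[ q ∈ vs ] (g q * ∑[ u ∈ xs ] (h u * [ σ u ≟ q ])) ∎
      where
      open ≡-Reasoning
      vs = allBoolVecs n

    ∑-partition : ∀ {n} {X : Set} (xs : List X) (σ : X → Vec Bool n) (g : Vec Bool n → A) →
                  ∑[ u ∈ xs ] g (σ u) ≡ ∑[ q ∈ allBoolVecs n ] (g q * ∑[ u ∈ xs ] [ σ u ≟ q ])
    ∑-partition {n} xs σ g = begin
      ∑[ u ∈ xs ] g (σ u)
        ≡⟨ ∑-cong xs (λ u → sym (*-identityˡ _)) ⟩
      ∑[ u ∈ xs ] (1# * g (σ u))
        ≡⟨ ∑-groupBy xs σ (λ _ → 1#) g ⟩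
      ∑[ q ∈ vs ] (g q * ∑[ u ∈ xs ] (1# * [ σ u ≟ q ]))
        ≡⟨ ∑-cong vs (λ q → cong (g q *_) (∑-cong xs (λ u → *-identityˡ _))) ⟩
      ∑[ q ∈ vs ] (g q * ∑[ u ∈ xs ] [ σ u ≟ q ]) ∎
      where
      open ≡-Reasoning
      vs = allBoolVecs n

    ∑-allFin-suc : ∀ {m} (f : Fin (suc m) → A) → ∑ (allFin (suc m)) f ≡ f Fin.zero + ∑[ i ∈ allFin m ] f (Fin.suc i)
    ∑-allFin-suc {m} f = cong (f Fin.zero +_)
      (trans (cong (λ is → ∑ is f) (sym (map-tabulate (λ i → i) Fin.suc))) (∑-map Fin.suc (allFin m) f))

    ∑-allFin-δ : ∀ {m} (a : Fin m) (h : Fin m → A) → ∑[ b ∈ allFin m ] (ind (toℕ b ≡ᵇ toℕ a) * h b) ≡ h a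
    ∑-allFin-δ {suc m} Fin.zero h = begin
      ∑[ b ∈ allFin (suc m) ] (ind (toℕ b ≡ᵇ 0) * h b)
        ≡⟨ ∑-allFin-suc (λ b → ind (toℕ b ≡ᵇ 0) * h b) ⟩
      1# * h Fin.zero + ∑[ b ∈ allFin m ] (0# * h (Fin.suc b))
        ≡⟨ cong₂ _+_ (*-identityˡ _) (trans (∑-cong (allFin m) (λ b → zeroˡ _)) (∑-zero (allFin m))) ⟩
      h Fin.zero + 0#
        ≡⟨ +-identityʳ _ ⟩
      h Fin.zero ∎
      where open ≡-Reasoning
    ∑-allFin-δ {suc m} (Fin.suc a) h = begin
      ∑[ b ∈ allFin (suc m) ] (ind (toℕ b ≡ᵇ toℕ (Fin.suc a)) * h b)
        ≡⟨ ∑-allFin-suc (λ b → ind (toℕ b ≡ᵇ toℕ (Fin.suc a)) * h b) ⟩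
      0# * h Fin.zero + ∑[ b ∈ allFin m ] (ind (toℕ b ≡ᵇ toℕ a) * h (Fin.suc b))
        ≡⟨ cong (_+ ∑[ b ∈ allFin m ] (ind (toℕ b ≡ᵇ toℕ a) * h (Fin.suc b))) (zeroˡ (h Fin.zero)) ⟩
      0# + ∑[ b ∈ allFin m ] (ind (toℕ b ≡ᵇ toℕ a) * h (Fin.suc b))
        ≡⟨ +-identityˡ _ ⟩
      ∑[ b ∈ allFin m ] (ind (toℕ b ≡ᵇ toℕ a) * h (Fin.suc b))
        ≡⟨ ∑-allFin-δ a (λ b → h (Fin.suc b)) ⟩
      h (Fin.suc a) ∎
      where open ≡-Reasoning

module ZeroTest where

  open import Data.Empty using (⊥; ⊥-elim)
  open import Data.Fin using (Fin)
  open import Data.Integer using (ℤ; 0ℤ; _+_; _*_; -_; _-_) renaming (_≟_ to _≟ℤ_)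
  open import Data.Integer.Properties using (*-zeroˡ; *-zeroʳ; *-distribˡ-+; i*j≡0⇒i≡0∨j≡0; +-*-isCommutativeSemiring)
  open import Data.Integer.Tactic.RingSolver using (solve-∀)
  open import Data.List using (List; []; _∷_; _++_; map; allFin)
  open import Data.List.Properties using (map-∘; map-id)
  open import Data.List.Membership.Propositional using (_∈_)
  open import Data.List.Membership.Propositional.Properties using (∈-++⁺ˡ; ∈-++⁺ʳ; ∈-++⁻; ∈-map⁺; ∈-map⁻; ∈-allFin)
  open import Data.List.Relation.Unary.All as All using (All; []; _∷_)
  open import Data.List.Relation.Unary.Any using (Any; here; there)
  open import Data.List.Relation.Unary.Any.Properties using (map⁻)
  open import Data.Maybe using (Maybe; just; nothing)
  open import Data.Nat using (ℕ; zero; suc)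
  open import Data.Nat.Properties using (suc-injective)
  open import Data.Product using (∃-syntax; _×_; _,_; proj₁; proj₂)
  open import Data.Sum using (_⊎_; inj₁; inj₂; [_,_]′)
  import Data.Sum as ⊎
  open import Data.Unit using (⊤; tt)
  open import Function using (id; _∘_)
  open import Relation.Binary.PropositionalEquality
  open import Relation.Nullary using (yes; no)

  open Sums
  open Sum +-*-isCommutativeSemiring using (∑; ∑-cong; ∑-distrib-+; ∑-*ˡ; *-left-comm; +-interchange)

  record IsLinear {I : Set} (f : (I → ℤ) → ℤ) : Set where
    field
      ≗-cong : ∀ {u v} → u ≗ v → f u ≡ f v
      +-hom  : ∀ u v → f (λ i → u i + v i) ≡ f u + f v
      *-hom  : ∀ c u → f (λ i → c * u i) ≡ c * f u

    0-hom : f (λ (_ : I) → 0ℤ) ≡ 0ℤ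
    0-hom = trans (*-hom 0ℤ (λ (_ : I) → 0ℤ)) (*-zeroˡ (f (λ _ → 0ℤ)))

  open IsLinear

  module _ {I : Set} where

    proj-linear : ∀ i → IsLinear {I} (λ u → u i)
    proj-linear i = record { ≗-cong = λ e → e i ; +-hom = λ _ _ → refl ; *-hom = λ _ _ → refl }

    +-linear : ∀ {f g : (I → ℤ) → ℤ} → IsLinear f → IsLinear g → IsLinear (λ u → f u + g u)
    +-linear {f} {g} lf lg = record
      { ≗-cong = λ e → cong₂ _+_ (≗-cong lf e) (≗-cong lg e)
      ; +-hom  = λ u v → trans (cong₂ _+_ (+-hom lf u v) (+-hom lg u v)) (+-interchange (f u) (f v) (g u) (g v))
      ; *-hom  = λ c u → trans (cong₂ _+_ (*-hom lf c u) (*-hom lg c u)) (sym (*-distribˡ-+ c (f u) (g u)))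
      }

    -‿linear : ∀ {f g : (I → ℤ) → ℤ} → IsLinear f → IsLinear g → IsLinear (λ u → f u - g u)
    -‿linear {f} {g} lf lg = record
      { ≗-cong = λ e → cong₂ _-_ (≗-cong lf e) (≗-cong lg e)
      ; +-hom  = λ u v → trans (cong₂ _-_ (+-hom lf u v) (+-hom lg u v)) ([a+b]-[c+d]≡[a-c]+[b-d] (f u) (f v) (g u) (g v))
      ; *-hom  = λ c u → trans (cong₂ _-_ (*-hom lf c u) (*-hom lg c u)) (c*a-c*b≡c*[a-b] c (f u) (g u))
      }
      where
      [a+b]-[c+d]≡[a-c]+[b-d] : ∀ a b c d → (a + b) - (c + d) ≡ (a - c) + (b - d)
      [a+b]-[c+d]≡[a-c]+[b-d] = solve-∀
      c*a-c*b≡c*[a-b] : ∀ c a b → c * a - c * b ≡ c * (a - b)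
      c*a-c*b≡c*[a-b] = solve-∀

    scale-linear : ∀ {f : (I → ℤ) → ℤ} c → IsLinear f → IsLinear (λ u → c * f u)
    scale-linear {f} c lf = record
      { ≗-cong = λ e → cong (c *_) (≗-cong lf e)
      ; +-hom  = λ u v → trans (cong (c *_) (+-hom lf u v)) (*-distribˡ-+ c (f u) (f v))
      ; *-hom  = λ d u → trans (cong (c *_) (*-hom lf d u)) (*-left-comm c d (f u))
      }

    ∑-linear : ∀ {X : Set} (xs : List X) {f : X → (I → ℤ) → ℤ} →
               (∀ x → IsLinear (f x)) → IsLinear (λ u → ∑ xs (λ x → f x u))
    ∑-linear xs {f} lf = record
      { ≗-cong = λ e → ∑-cong xs (λ x → ≗-cong (lf x) e)
      ; +-hom  = λ u v → trans (∑-cong xs (λ x → +-hom (lf x) u v)) (∑-distrib-+ xs (λ x → f x u) (λ x → f x v))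
      ; *-hom  = λ c u → trans (∑-cong xs (λ x → *-hom (lf x) c u)) (∑-*ˡ xs c (λ x → f x u))
      }

    ∑-combination-linear : ∀ {X : Set} (xs : List X) (c : X → ℤ) {f : X → (I → ℤ) → ℤ} →
                           (∀ x → IsLinear (f x)) → IsLinear (λ u → ∑ xs (λ x → c x * f x u))
    ∑-combination-linear xs c lf = ∑-linear xs (λ x → scale-linear (c x) (lf x))

  reindex-linear : ∀ {I J : Set} (h : J → I) {f : (J → ℤ) → ℤ} → IsLinear f → IsLinear (λ (u : I → ℤ) → f (λ j → u (h j)))
  reindex-linear h lf = record
    { ≗-cong = λ e → ≗-cong lf (λ j → e (h j))
    ; +-hom  = λ u v → +-hom lf (λ j → u (h j)) (λ j → v (h j))
    ; *-hom  = λ c u → *-hom lf c (λ j → u (h j))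
    }

  module Decide {I : Set} (indices : List I) (∈-indices : ∀ i → i ∈ indices)
                {K : ℕ} (T : Fin K → (I → ℤ) → (I → ℤ)) (T-linear : ∀ a i → IsLinear (λ u → T a u i))
                (φ : (I → ℤ) → ℤ) (φ-linear : IsLinear φ) (y₀ : I → ℤ) where

    V : Set
    V = I → ℤ

    𝟎 : V
    𝟎 _ = 0ℤ

    _⊕_ : V → V → V
    (u ⊕ v) i = u i + v i

    _⊙_ : ℤ → V → V
    (c ⊙ u) i = c * u i

    run : List (Fin K) → V → V
    run []      v = v
    run (a ∷ w) v = T a (run w v)

    -- The rational span of M, kept inside ℤ: dividing by a non-zero scalar is allowed.
    data Span (M : V → Set) : V → Set where
      zero∈   : Span M 𝟎
      gen     : ∀ {v} → M v → Span M v
      _+∈_    : ∀ {u v} → Span M u → Span M v → Span M (u ⊕ v)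
      scale   : ∀ {u} c → Span M u → Span M (c ⊙ u)
      unscale : ∀ {u} c → c ≢ 0ℤ → Span M (c ⊙ u) → Span M u
      respect : ∀ {u v} → u ≗ v → Span M u → Span M v

    Span-bind : ∀ {M M′} → (∀ {v} → M v → Span M′ v) → ∀ {u} → Span M u → Span M′ u
    Span-bind f zero∈             = zero∈
    Span-bind f (gen m)           = f m
    Span-bind f (p +∈ q)          = Span-bind f p +∈ Span-bind f q
    Span-bind f (scale c p)       = scale c (Span-bind f p)
    Span-bind f (unscale c c≢0 p) = unscale c c≢0 (Span-bind f p)
    Span-bind f (respect e p)     = respect e (Span-bind f p)

    Span-map : ∀ {M} a → (∀ {v} → M v → Span M (T a v)) → ∀ {u} → Span M u → Span M (T a u)
    Span-map a f zero∈                 = respect (λ i → sym (0-hom (T-linear a i))) zero∈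
    Span-map a f (gen m)               = f m
    Span-map a f (_+∈_ {u} {v} p q)    = respect (λ i → sym (+-hom (T-linear a i) u v)) (Span-map a f p +∈ Span-map a f q)
    Span-map a f (scale {u} c p)       = respect (λ i → sym (*-hom (T-linear a i) c u)) (scale c (Span-map a f p))
    Span-map a f (unscale {u} c c≢0 p) = unscale c c≢0 (respect (λ i → *-hom (T-linear a i) c u) (Span-map a f p))
    Span-map a f (respect e p)          = respect (λ i → ≗-cong (T-linear a i) e) (Span-map a f p)

    Span-nonzero : ∀ {M u} → Span M u → φ u ≢ 0ℤ → ∃[ v ] (M v × φ v ≢ 0ℤ)
    Span-nonzero zero∈ φ≢0 = ⊥-elim (φ≢0 (0-hom φ-linear))
    Span-nonzero (gen m) φ≢0 = _ , m , φ≢0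
    Span-nonzero (_+∈_ {u} {v} p q) φ≢0 with φ u ≟ℤ 0ℤ
    ... | no  φu≢0 = Span-nonzero p φu≢0
    ... | yes φu≡0 = Span-nonzero q λ φv≡0 →
      φ≢0 (trans (+-hom φ-linear u v) (cong₂ _+_ φu≡0 φv≡0))
    Span-nonzero (scale {u} c p) φ≢0 = Span-nonzero p λ φu≡0 →
      φ≢0 (trans (*-hom φ-linear c u) (trans (cong (c *_) φu≡0) (*-zeroʳ c)))
    Span-nonzero (unscale {u} c c≢0 p) φ≢0 = Span-nonzero p λ φcu≡0 →
      φ≢0 ([ (λ c≡0 → ⊥-elim (c≢0 c≡0)) , id ]′ (i*j≡0⇒i≡0∨j≡0 c (trans (sym (*-hom φ-linear c u)) φcu≡0)))
    Span-nonzero (respect e p) φ≢0 = Span-nonzero p λ φu≡0 → φ≢0 (trans (sym (≗-cong φ-linear e)) φu≡0)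

    Span-kernel : ∀ {M} → (∀ {v} → M v → φ v ≡ 0ℤ) → ∀ {u} → Span M u → φ u ≡ 0ℤ
    Span-kernel φM≡0 {u} p with φ u ≟ℤ 0ℤ
    ... | yes φu≡0 = φu≡0
    ... | no  φu≢0 with Span-nonzero p φu≢0
    ...   | _ , m , φv≢0 = ⊥-elim (φv≢0 (φM≡0 m))

    Reachable : V → Set
    Reachable v = ∃[ w ] run w y₀ ≡ v

    Reach : V → Set
    Reach = Span Reachable

    Reach-T : ∀ a {u} → Reach u → Reach (T a u)
    Reach-T a = Span-map a (λ { (w , refl) → gen (a ∷ w , refl) })

    -- One slot per index; a filled slot (i , just b) holds the basis vector with pivot i.
    Slots : Set
    Slots = List (I × Maybe V)

    _∈ˢ_ : V → Slots → Set
    v ∈ˢ bs = Any (λ s → proj₂ s ≡ just v) bs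

    holes : Slots → ℕ
    holes []                   = 0
    holes ((_ , nothing) ∷ bs) = suc (holes bs)
    holes ((_ , just _)  ∷ bs) = holes bs

    VanishOn : List I → V → Set
    VanishOn ps v = All (λ j → v j ≡ 0ℤ) ps

    -- ps lists the indices of the slots to the left of bs.
    Echelon : List I → Slots → Set
    Echelon ps []                   = ⊤
    Echelon ps ((i , nothing) ∷ bs) = Echelon (i ∷ ps) bs
    Echelon ps ((i , just b)  ∷ bs) = b i ≢ 0ℤ × VanishOn ps b × Echelon (i ∷ ps) bs

    Covers : List I → Slots → Set
    Covers ps bs = ∀ j → j ∈ ps ⊎ Any (λ s → j ≡ proj₁ s) bs

    Covers-step : ∀ {ps i m bs} → Covers ps ((i , m) ∷ bs) → Covers (i ∷ ps) bs
    Covers-step covers j with covers j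
    ... | inj₁ j∈ps         = inj₁ (there j∈ps)
    ... | inj₂ (here refl)  = inj₁ (here refl)
    ... | inj₂ (there j∈bs) = inj₂ j∈bs

    _◃_ : V → Slots → V → Set
    (v ◃ bs) u = u ≡ v ⊎ u ∈ˢ bs

    ◃-there : ∀ {v bs s u} → (v ◃ bs) u → (v ◃ (s ∷ bs)) u
    ◃-there = ⊎.map₂ there

    record Extension (ps : List I) (v : V) (bs : Slots) : Set where
      field
        new       : V
        slots     : Slots
        filled    : holes bs ≡ suc (holes slots)
        echelon   : Echelon ps slots
        indexed   : map proj₁ slots ≡ map proj₁ bs
        slots-⊆   : ∀ {u} → u ∈ˢ slots → (new ◃ bs) u
        slots-⊇   : ∀ {u} → u ∈ˢ bs → u ∈ˢ slots
        new∈slots : new ∈ˢ slots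
        v∈span    : Span (new ◃ bs) v
        new∈span  : Span (v ◃ bs) new

    eliminate : V → I → V → V
    eliminate b i v = (b i ⊙ v) ⊕ ((- v i) ⊙ b)

    eliminate-pivot : ∀ b i v → eliminate b i v i ≡ 0ℤ
    eliminate-pivot b i v = x*y-y*x≡0 (b i) (v i)
      where
      x*y-y*x≡0 : ∀ x y → x * y + (- y) * x ≡ 0ℤ
      x*y-y*x≡0 = solve-∀

    eliminate-vanishOn : ∀ {ps} b i v → VanishOn ps v → VanishOn ps b → VanishOn ps (eliminate b i v)
    eliminate-vanishOn b i v []               []               = []
    eliminate-vanishOn b i v (vj≡0 ∷ v-rest) (bj≡0 ∷ b-rest) =
      trans (cong₂ (λ x y → b i * x + (- v i) * y) vj≡0 bj≡0) (x*0-y*0≡0 (b i) (v i))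
      ∷ eliminate-vanishOn b i v v-rest b-rest
      where
      x*0-y*0≡0 : ∀ x y → x * 0ℤ + (- y) * 0ℤ ≡ 0ℤ
      x*0-y*0≡0 = solve-∀

    eliminate∈ : ∀ {M b v} i → Span M v → Span M b → Span M (eliminate b i v)
    eliminate∈ {b = b} {v} i pv pb = scale (b i) pv +∈ scale (- v i) pb

    restore∈ : ∀ {M b v} i → b i ≢ 0ℤ → Span M (eliminate b i v) → Span M b → Span M v
    restore∈ {b = b} {v} i bi≢0 pe pb =
      unscale (b i) bi≢0 (respect (λ j → sym (x*y≡[x*y-z*w]+z*w (b i) (v j) (v i) (b j))) (pe +∈ scale (v i) pb))
      where
      x*y≡[x*y-z*w]+z*w : ∀ x y z w → x * y ≡ (x * y + (- z) * w) + z * w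
      x*y≡[x*y-z*w]+z*w = solve-∀

    fill-hole : ∀ {ps v i bs} → v i ≢ 0ℤ → VanishOn ps v → Echelon (i ∷ ps) bs →
                Extension ps v ((i , nothing) ∷ bs)
    fill-hole {v = v} {i} {bs} vi≢0 v≈0 ech = record
      { new       = v
      ; slots     = (i , just v) ∷ bs
      ; filled    = refl
      ; echelon   = vi≢0 , v≈0 , ech
      ; indexed   = refl
      ; slots-⊆   = λ { (here refl) → inj₁ refl ; (there m) → inj₂ (there m) }
      ; slots-⊇   = λ { (here ()) ; (there m) → there m }
      ; new∈slots = here refl
      ; v∈span    = gen (inj₁ refl)
      ; new∈span  = gen (inj₁ refl)
      }

    skip-hole : ∀ {ps v i bs} → Extension (i ∷ ps) v bs → Extension ps v ((i , nothing) ∷ bs)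
    skip-hole {i = i} ext = record
      { new       = new
      ; slots     = (i , nothing) ∷ slots
      ; filled    = cong suc filled
      ; echelon   = echelon
      ; indexed   = cong (i ∷_) indexed
      ; slots-⊆   = λ { (here ()) ; (there m) → ◃-there (slots-⊆ m) }
      ; slots-⊇   = λ { (here ()) ; (there m) → there (slots-⊇ m) }
      ; new∈slots = there new∈slots
      ; v∈span    = Span-bind (gen ∘ ◃-there) v∈span
      ; new∈span  = Span-bind (gen ∘ ◃-there) new∈span
      }
      where open Extension ext

    pass-pivot : ∀ {ps v i b bs} → b i ≢ 0ℤ → VanishOn ps b →
                 Extension (i ∷ ps) (eliminate b i v) bs → Extension ps v ((i , just b) ∷ bs)
    pass-pivot {v = v} {i} {b} bi≢0 b≈0 ext = record
      { new       = new
      ; slots     = (i , just b) ∷ slots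
      ; filled    = filled
      ; echelon   = bi≢0 , b≈0 , echelon
      ; indexed   = cong (i ∷_) indexed
      ; slots-⊆   = λ { (here e) → inj₂ (here e) ; (there m) → ◃-there (slots-⊆ m) }
      ; slots-⊇   = λ { (here e) → here e ; (there m) → there (slots-⊇ m) }
      ; new∈slots = there new∈slots
      ; v∈span    = restore∈ i bi≢0 (Span-bind (gen ∘ ◃-there) v∈span) (gen (inj₂ (here refl)))
      ; new∈span  = Span-bind (λ { (inj₁ refl) → eliminate∈ i (gen (inj₁ refl)) (gen (inj₂ (here refl)))
                                ; (inj₂ m)    → gen (inj₂ (there m)) })
                             new∈span
      }
      where open Extension ext

    reduce : ∀ ps v → VanishOn ps v → ∀ bs → Echelon ps bs → Covers ps bs →
             Span (_∈ˢ bs) v ⊎ Extension ps v bs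
    reduce ps v v≈0 [] _ covers = inj₁ (respect (λ j → sym (vanish j)) zero∈)
      where
      vanish : ∀ j → v j ≡ 0ℤ
      vanish j with covers j
      ... | inj₁ j∈ps = All.lookup v≈0 j∈ps
    reduce ps v v≈0 ((i , nothing) ∷ bs) ech covers with v i ≟ℤ 0ℤ
    ... | no  vi≢0 = inj₂ (fill-hole vi≢0 v≈0 ech)
    ... | yes vi≡0 = ⊎.map (Span-bind (gen ∘ there)) skip-hole
                       (reduce (i ∷ ps) v (vi≡0 ∷ v≈0) bs ech (Covers-step covers))
    reduce ps v v≈0 ((i , just b) ∷ bs) (bi≢0 , b≈0 , ech) covers =
      ⊎.map (λ p → restore∈ i bi≢0 (Span-bind (gen ∘ there) p) (gen (here refl)))
            (pass-pivot bi≢0 b≈0)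
            (reduce (i ∷ ps) (eliminate b i v)
                    (eliminate-pivot b i v ∷ eliminate-vanishOn b i v v≈0 b≈0) bs ech (Covers-step covers))

    Pool : Slots → List V → V → Set
    Pool bs W u = u ∈ˢ bs ⊎ u ∈ W

    record Invariant (bs : Slots) (W : List V) : Set where
      field
        echelon         : Echelon [] bs
        indexed         : map proj₁ bs ≡ indices
        basis-reachable : ∀ {u} → u ∈ˢ bs → Reach u
        basis-kernel    : ∀ {u} → u ∈ˢ bs → φ u ≡ 0ℤ
        work-reachable  : ∀ {u} → u ∈ W → Reach u
        closed          : ∀ {u} → u ∈ˢ bs → ∀ a → Span (Pool bs W) (T a u)
        start           : Span (Pool bs W) y₀

    Covers-indexed : ∀ bs → map proj₁ bs ≡ indices → Covers [] bs
    Covers-indexed bs e j = inj₂ (map⁻ (subst (j ∈_) (sym e) (∈-indices j)))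

    saturated : ∀ {bs} → Invariant bs [] → ∀ w → φ (run w y₀) ≡ 0ℤ
    saturated {bs} inv w = Span-kernel (λ { (inj₁ m) → basis-kernel m }) (orbit w)
      where
      open Invariant inv
      orbit : ∀ w → Span (Pool bs []) (run w y₀)
      orbit []      = start
      orbit (a ∷ w) = Span-map a (λ { (inj₁ m) → closed m a }) (orbit w)

    absorb : ∀ {bs x W} → Span (_∈ˢ bs) x → Invariant bs (x ∷ W) → Invariant bs W
    absorb {bs} {x} {W} x∈span inv = record
      { echelon         = echelon
      ; indexed         = indexed
      ; basis-reachable = basis-reachable
      ; basis-kernel    = basis-kernel
      ; work-reachable  = work-reachable ∘ there
      ; closed          = λ m a → Span-bind lift (closed m a)
      ; start           = Span-bind lift start
      }
      where
      open Invariant inv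
      lift : ∀ {u} → Pool bs (x ∷ W) u → Span (Pool bs W) u
      lift (inj₁ m)           = gen (inj₁ m)
      lift (inj₂ (here refl)) = Span-bind (gen ∘ inj₁) x∈span
      lift (inj₂ (there m))   = gen (inj₂ m)

    new-reachable : ∀ {bs x W} → Invariant bs (x ∷ W) → (ext : Extension [] x bs) → Reach (Extension.new ext)
    new-reachable inv ext = Span-bind (λ { (inj₁ refl) → work-reachable (here refl)
                                         ; (inj₂ m)    → basis-reachable m })
                                      (Extension.new∈span ext)
      where open Invariant inv

    successors : V → List V
    successors v = map (λ a → T a v) (allFin K)

    enlarge : ∀ {bs x W} (ext : Extension [] x bs) → φ (Extension.new ext) ≡ 0ℤ → Invariant bs (x ∷ W) →
              Invariant (Extension.slots ext) (successors (Extension.new ext) ++ W)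
    enlarge {bs} {x} {W} ext φ≡0 inv = record
      { echelon         = Extension.echelon ext
      ; indexed         = trans (Extension.indexed ext) indexed
      ; basis-reachable = λ m → [ (λ { refl → reach-new }) , basis-reachable ]′ (slots-⊆ m)
      ; basis-kernel    = λ m → [ (λ { refl → φ≡0 }) , basis-kernel ]′ (slots-⊆ m)
      ; work-reachable  = λ m → [ successor-reachable , work-reachable ∘ there ]′ (∈-++⁻ (successors new) m)
      ; closed          = λ m a → [ (λ { refl → gen (inj₂ (∈-++⁺ˡ (∈-map⁺ (λ a → T a new) (∈-allFin a)))) })
                                  , (λ m′ → Span-bind lift (closed m′ a)) ]′ (slots-⊆ m)
      ; start           = Span-bind lift start
      }
      where
      open Invariant inv
      open Extension ext using (new; slots; slots-⊆; slots-⊇; new∈slots; v∈span)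
      reach-new : Reach new
      reach-new = new-reachable inv ext
      successor-reachable : ∀ {u} → u ∈ successors new → Reach u
      successor-reachable m with ∈-map⁻ (λ a → T a new) m
      ... | a , _ , refl = Reach-T a reach-new
      lift : ∀ {u} → Pool bs (x ∷ W) u → Span (Pool slots (successors new ++ W)) u
      lift (inj₁ m)           = gen (inj₁ (slots-⊇ m))
      lift (inj₂ (here refl)) = Span-bind (λ { (inj₁ refl) → gen (inj₁ new∈slots)
                                             ; (inj₂ m)    → gen (inj₁ (slots-⊇ m)) }) v∈span
      lift (inj₂ (there m))   = gen (inj₂ (∈-++⁺ʳ (successors new) m))

    Outcome : Set
    Outcome = (∀ w → φ (run w y₀) ≡ 0ℤ) ⊎ (∃[ w ] φ (run w y₀) ≢ 0ℤ)

    -- Terminates because every extension fills one of the finitely many slots.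
    saturate : ∀ e bs W → holes bs ≡ e → Invariant bs W → Outcome
    saturate e bs []      _  inv = inj₁ (saturated inv)
    saturate e bs (x ∷ W) he inv
      with reduce [] x [] bs (Invariant.echelon inv) (Covers-indexed bs (Invariant.indexed inv))
    ... | inj₁ x∈span = saturate e bs W he (absorb x∈span inv)
    ... | inj₂ ext with φ (Extension.new ext) ≟ℤ 0ℤ
    ...   | no  φ≢0 = inj₂ (witness (Span-nonzero (new-reachable inv ext) φ≢0))
      where
      witness : ∃[ v ] (Reachable v × φ v ≢ 0ℤ) → ∃[ w ] φ (run w y₀) ≢ 0ℤ
      witness (_ , (w , refl) , φ≢0) = w , φ≢0
    ...   | yes φ≡0 = descend e he
      where
      descend : ∀ e → holes bs ≡ e → Outcome
      descend zero    he with () ← trans (sym (Extension.filled ext)) he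
      descend (suc e) he = saturate e (Extension.slots ext) (successors (Extension.new ext) ++ W)
                                    (suc-injective (trans (sym (Extension.filled ext)) he))
                                    (enlarge ext φ≡0 inv)

    empty-slots : List I → Slots
    empty-slots = map (λ i → i , nothing)

    Echelon-empty : ∀ ps is → Echelon ps (empty-slots is)
    Echelon-empty ps []       = tt
    Echelon-empty ps (i ∷ is) = Echelon-empty (i ∷ ps) is

    ∉-empty-slots : ∀ {u} is → u ∈ˢ empty-slots is → ⊥
    ∉-empty-slots (i ∷ is) (there m) = ∉-empty-slots is m

    initial : Invariant (empty-slots indices) (y₀ ∷ [])
    initial = record
      { echelon         = Echelon-empty [] indices
      ; indexed         = trans (sym (map-∘ indices)) (map-id indices)
      ; basis-reachable = ⊥-elim ∘ ∉-empty-slots indices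
      ; basis-kernel    = ⊥-elim ∘ ∉-empty-slots indices
      ; work-reachable  = λ { (here refl) → gen ([] , refl) }
      ; closed          = ⊥-elim ∘ ∉-empty-slots indices
      ; start           = gen (inj₂ (here refl))
      }

    decide : Outcome
    decide = saturate _ (empty-slots indices) (y₀ ∷ []) refl initial

module Support where

  open import Data.Bool using (Bool; true; false; _∧_; _∨_)
  open import Data.Bool.Properties using (∧-zeroʳ)
  open import Data.Empty using (⊥-elim)
  open import Data.Fin using (Fin)
  open import Data.Integer using (+_) renaming (_+_ to _+ℤ_; _*_ to _*ℤ_)
  open import Data.Integer.Properties using (pos-+; pos-*) renaming (+-*-isCommutativeSemiring to ℤ-isCommutativeSemiring)
  open import Data.List using (List; []; _∷_; allFin; tabulate)
  open import Data.Nat using (ℕ; zero; suc; _+_; _*_)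
  open import Data.Nat.Properties using (+-*-isCommutativeSemiring; *-assoc)
  open import Data.Vec using (Vec; lookup) renaming (tabulate to tabulateᵛ)
  open import Data.Vec.Properties using (lookup∘tabulate; tabulate-cong)
  open import Function using (_∘_)
  open import Relation.Binary.PropositionalEquality

  open Sums
  open Sum +-*-isCommutativeSemiring

  sumFin-∘ : ∀ {m} {X : Set} (g : Fin m → X) (f : X → ℕ) → sumFin (f ∘ g) ≡ ∑ (tabulate g) f
  sumFin-∘ {zero}  g f = refl
  sumFin-∘ {suc m} g f = cong (_+_ (f (g Fin.zero))) (sumFin-∘ (g ∘ Fin.suc) f)

  sumFin-∑ : ∀ {m} (f : Fin m → ℕ) → sumFin f ≡ ∑ (allFin m) f
  sumFin-∑ = sumFin-∘ (λ i → i)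

  module ℤ∑ = Sum ℤ-isCommutativeSemiring

  pos-∑-* : ∀ {X : Set} (xs : List X) (c f : X → ℕ) → + ∑[ x ∈ xs ] (c x * f x) ≡ ℤ∑.∑ xs (λ x → + c x *ℤ + f x)
  pos-∑-* []       c f = refl
  pos-∑-* (x ∷ xs) c f = trans (pos-+ (c x * f x) _) (cong₂ _+ℤ_ (pos-* (c x) (f x)) (pos-∑-* xs c f))

  positive : ℕ → Bool
  positive zero    = false
  positive (suc _) = true

  positive-+ : ∀ a b → positive (a + b) ≡ positive a ∨ positive b
  positive-+ zero    b = refl
  positive-+ (suc a) b = refl

  positive-* : ∀ a b → positive (a * b) ≡ positive a ∧ positive b
  positive-* zero    b       = refl
  positive-* (suc a) zero    = trans (positive-* a zero) (∧-zeroʳ (positive a))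
  positive-* (suc a) (suc b) = refl

  positive-false : ∀ m → positive m ≡ false → m ≡ 0
  positive-false zero _ = refl

  positive-nonzero : ∀ m → m ≢ 0 → positive m ≡ true
  positive-nonzero zero    m≢0 = ⊥-elim (m≢0 refl)
  positive-nonzero (suc m) _   = refl

  positive-ind : ∀ b → positive (ind b) ≡ b
  positive-ind true  = refl
  positive-ind false = refl

  -- This is why the support of an ℕ-rational series is recognised by a finite automaton.
  positive-∑-support : ∀ {X : Set} (xs : List X) (c f : X → ℕ) →
                       positive (∑[ x ∈ xs ] (c x * f x)) ≡ positive (∑[ x ∈ xs ] (c x * ind (positive (f x))))
  positive-∑-support []       c f = refl
  positive-∑-support (x ∷ xs) c f = begin
    positive (c x * f x + ∑[ y ∈ xs ] (c y * f y))
      ≡⟨ positive-+ (c x * f x) _ ⟩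
    positive (c x * f x) ∨ positive (∑[ y ∈ xs ] (c y * f y))
      ≡⟨ cong₂ _∨_ (trans (positive-* (c x) (f x)) (cong (positive (c x) ∧_) (sym (positive-ind (positive (f x))))))
                   (positive-∑-support xs c f) ⟩
    (positive (c x) ∧ positive (ind (positive (f x)))) ∨ positive (∑[ y ∈ xs ] (c y * ind (positive (f y))))
      ≡⟨ cong (_∨ _) (sym (positive-* (c x) _)) ⟩
    positive (c x * ind (positive (f x))) ∨ positive (∑[ y ∈ xs ] (c y * ind (positive (f y))))
      ≡⟨ sym (positive-+ (c x * ind (positive (f x))) _) ⟩
    positive (c x * ind (positive (f x)) + ∑[ y ∈ xs ] (c y * ind (positive (f y)))) ∎
    where open ≡-Reasoning

  module Automaton {k n : ℕ} (r : Rep k n) where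

    open Rep r renaming (row to λ⃗; mu to μ; col to ν)

    State : Set
    State = Vec Bool n

    column : Word k → Fin n → ℕ
    column w i = sumFin (λ j → muStar μ w i j * ν j)

    column-∷ : ∀ a w i → column (a ∷ w) i ≡ ∑[ l ∈ allFin n ] (μ a i l * column w l)
    column-∷ a w i = begin
      sumFin (λ j → sumFin (λ l → μ a i l * muStar μ w l j) * ν j)
        ≡⟨ sumFin-∑ (λ j → sumFin (λ l → μ a i l * muStar μ w l j) * ν j) ⟩
      ∑[ j ∈ js ] (sumFin (λ l → μ a i l * muStar μ w l j) * ν j)
        ≡⟨ ∑-cong js (λ j → trans (cong (_* ν j) (sumFin-∑ (λ l → μ a i l * muStar μ w l j))) (sym (∑-*ʳ js (ν j) _))) ⟩
      ∑[ j ∈ js ] ∑[ l ∈ js ] (μ a i l * muStar μ w l j * ν j)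
        ≡⟨ ∑-comm js js _ ⟩
      ∑[ l ∈ js ] ∑[ j ∈ js ] (μ a i l * muStar μ w l j * ν j)
        ≡⟨ ∑-cong js (λ l → trans (∑-cong js (λ j → *-assoc (μ a i l) _ _)) (∑-*ˡ js (μ a i l) _)) ⟩
      ∑[ l ∈ js ] (μ a i l * ∑[ j ∈ js ] (muStar μ w l j * ν j))
        ≡⟨ ∑-cong js (λ l → cong (μ a i l *_) (sym (sumFin-∑ (λ j → muStar μ w l j * ν j)))) ⟩
      ∑[ l ∈ js ] (μ a i l * column w l) ∎
      where
      open ≡-Reasoning
      js = allFin n

    series-column : ∀ w → series r w ≡ ∑[ i ∈ allFin n ] (λ⃗ i * column w i)
    series-column w = begin
      sumFin (λ i → sumFin (λ j → λ⃗ i * muStar μ w i j * ν j))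
        ≡⟨ sumFin-∑ (λ i → sumFin (λ j → λ⃗ i * muStar μ w i j * ν j)) ⟩
      ∑[ i ∈ is ] sumFin (λ j → λ⃗ i * muStar μ w i j * ν j)
        ≡⟨ ∑-cong is (λ i → sumFin-∑ (λ j → λ⃗ i * muStar μ w i j * ν j)) ⟩
      ∑[ i ∈ is ] ∑[ j ∈ is ] (λ⃗ i * muStar μ w i j * ν j)
        ≡⟨ ∑-cong is (λ i → trans (∑-cong is (λ j → *-assoc (λ⃗ i) _ _)) (∑-*ˡ is (λ⃗ i) _)) ⟩
      ∑[ i ∈ is ] (λ⃗ i * ∑[ j ∈ is ] (muStar μ w i j * ν j))
        ≡⟨ ∑-cong is (λ i → cong (λ⃗ i *_) (sym (sumFin-∑ (λ j → muStar μ w i j * ν j)))) ⟩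
      ∑[ i ∈ is ] (λ⃗ i * column w i) ∎
      where
      open ≡-Reasoning
      is = allFin n

    support : (Fin n → ℕ) → State
    support c = tabulateᵛ (positive ∘ c)

    state : Word k → State
    state w = support (column w)

    step : Fin k → State → State
    step a p = tabulateᵛ (λ i → positive (∑[ l ∈ allFin n ] (μ a i l * ind (lookup p l))))

    accepting : State → Bool
    accepting p = positive (∑[ i ∈ allFin n ] (λ⃗ i * ind (lookup p i)))

    Supp : Language k
    Supp w = accepting (state w)

    positive-∑-state : ∀ w (c : Fin n → ℕ) →
                       positive (∑[ i ∈ allFin n ] (c i * column w i)) ≡
                       positive (∑[ i ∈ allFin n ] (c i * ind (lookup (state w) i)))
    positive-∑-state w c = trans (positive-∑-support (allFin n) c (column w))
      (cong positive (∑-cong (allFin n) (λ i → cong (λ b → c i * ind b) (sym (lookup∘tabulate _ i)))))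

    state-∷ : ∀ a w → state (a ∷ w) ≡ step a (state w)
    state-∷ a w = tabulate-cong λ i →
      trans (cong positive (column-∷ a w i)) (positive-∑-state w (μ a i))

    positive-series : ∀ w → positive (series r w) ≡ Supp w
    positive-series w = trans (cong positive (series-column w)) (positive-∑-state w λ⃗)

    series≢0⇒Supp : ∀ w → series r w ≢ 0 → Supp w ≡ true
    series≢0⇒Supp w s≢0 = trans (sym (positive-series w)) (positive-nonzero (series r w) s≢0)

    Supp⇒series≢0 : ∀ w → Supp w ≡ true → series r w ≢ 0
    Supp⇒series≢0 w e s≡0 with () ← trans (trans (sym (cong positive s≡0)) (positive-series w)) e

module Counting where

  open import Data.Bool using (Bool; true; false; _∧_; _∨_)
  open import Data.Bool.Properties using (T?; ∧-identityʳ; T-≡)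
  open import Data.Fin using (Fin; toℕ)
  open import Data.Integer using (ℤ; +_; 1ℤ; _+_; _*_)
  open import Data.Integer.Properties using (+-*-isCommutativeSemiring; +-identityˡ; +-identityʳ; *-comm; *-assoc; *-distribʳ-+)
  open import Data.List using (List; []; _∷_; _++_; map; allFin; length; filter; upTo)
  open import Data.List.Properties using (upTo-∷ʳ)
  open import Data.List.Membership.Propositional using (_∈_)
  open import Data.List.Membership.Propositional.Properties using (∈-upTo⁻)
  open import Data.List.Relation.Unary.All as All using (All; []; _∷_)
  open import Data.List.Relation.Unary.All.Properties using (concat⁺; map⁺)
  open import Data.Nat using (ℕ; zero; suc; _<ᵇ_; _≡ᵇ_)
  open import Data.Nat.Properties using (<⇒<ᵇ)
  open import Function using (_∘_)
  open import Function.Bundles using (Equivalence)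
  open import Relation.Binary.PropositionalEquality

  open Sums
  open Sum +-*-isCommutativeSemiring
  open Support

  length-filter : ∀ {X : Set} (p : X → Bool) xs → + length (filter (T? ∘ p) xs) ≡ ∑[ u ∈ xs ] ind (p u)
  length-filter p []       = refl
  length-filter p (x ∷ xs) with p x
  ... | true  = cong (_+_ 1ℤ) (length-filter p xs)
  ... | false = trans (length-filter p xs) (sym (+-identityˡ _))

  ind-∨-exclusive : ∀ x y z → x ∧ y ≡ false → ind (x ∨ (y ∧ z)) ≡ ind x + ind y * ind z
  ind-∨-exclusive true  true  z     ()
  ind-∨-exclusive true  false z     _ = refl
  ind-∨-exclusive false true  true  _ = refl
  ind-∨-exclusive false true  false _ = refl
  ind-∨-exclusive false false z     _ = refl

  <ᵇ-≡ᵇ-exclusive : ∀ x y → (x <ᵇ y) ∧ (x ≡ᵇ y) ≡ false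
  <ᵇ-≡ᵇ-exclusive zero    zero    = refl
  <ᵇ-≡ᵇ-exclusive zero    (suc y) = refl
  <ᵇ-≡ᵇ-exclusive (suc x) zero    = refl
  <ᵇ-≡ᵇ-exclusive (suc x) (suc y) = <ᵇ-≡ᵇ-exclusive x y

  <ᵇ-irrefl : ∀ m → (m <ᵇ m) ≡ false
  <ᵇ-irrefl zero    = refl
  <ᵇ-irrefl (suc m) = <ᵇ-irrefl m

  ≡ᵇ-refl : ∀ m → (m ≡ᵇ m) ≡ true
  ≡ᵇ-refl zero    = refl
  ≡ᵇ-refl (suc m) = ≡ᵇ-refl m

  module _ (k : ℕ) where

    length-wordsOfLength : ∀ m → All (λ u → length u ≡ m) (wordsOfLength k m)
    length-wordsOfLength zero    = refl ∷ []
    length-wordsOfLength (suc m) =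
      concat⁺ (map⁺ (All.universal (λ a → map⁺ (All.map (cong suc) (length-wordsOfLength m))) (allFin k)))

    ∑-wordsOfLength-suc : ∀ m (f : Word k → ℤ) →
      ∑ (wordsOfLength k (suc m)) f ≡ ∑[ a ∈ allFin k ] ∑[ u ∈ wordsOfLength k m ] f (a ∷ u)
    ∑-wordsOfLength-suc m f = trans (∑-concatMap (λ a → map (a ∷_) (wordsOfLength k m)) (allFin k) f)
      (∑-cong (allFin k) (λ a → ∑-map (a ∷_) (wordsOfLength k m) f))

  module Counts {k n : ℕ} (r : Rep k n) where

    open Automaton r

    private
      Wd : ℕ → List (Word k)
      Wd = wordsOfLength k
      states : List State
      states = allBoolVecs n

    count : ℕ → State → ℤ
    count m q = ∑[ u ∈ Wd m ] [ state u ≟ q ]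

    countBelow : Word k → State → ℤ
    countBelow w q = ∑[ u ∈ Wd (length w) ] (ind (lexLt u w) * [ state u ≟ q ])

    countShorter : ℕ → ℤ
    countShorter m = ∑[ j ∈ upTo m ] ∑[ u ∈ Wd j ] ind (Supp u)

    ∑-step : ∀ m b q (h : Word k → ℤ) →
             ∑[ u ∈ Wd m ] (h u * [ state (b ∷ u) ≟ q ]) ≡
             ∑[ q′ ∈ states ] ([ step b q′ ≟ q ] * ∑[ u ∈ Wd m ] (h u * [ state u ≟ q′ ]))
    ∑-step m b q h = trans (∑-cong (Wd m) (λ u → cong (λ p → h u * [ p ≟ q ]) (state-∷ b u)))
                           (∑-groupBy (Wd m) state h (λ q′ → [ step b q′ ≟ q ]))

    count-step : ∀ m b q → ∑[ u ∈ Wd m ] [ state (b ∷ u) ≟ q ] ≡ ∑[ q′ ∈ states ] ([ step b q′ ≟ q ] * count m q′)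
    count-step m b q = trans (∑-cong (Wd m) (λ u → cong (λ p → [ p ≟ q ]) (state-∷ b u)))
                             (∑-partition (Wd m) state (λ q′ → [ step b q′ ≟ q ]))

    count-suc : ∀ m q → count (suc m) q ≡ ∑[ b ∈ allFin k ] ∑[ q′ ∈ states ] ([ step b q′ ≟ q ] * count m q′)
    count-suc m q = trans (∑-wordsOfLength-suc k m (λ u → [ state u ≟ q ])) (∑-cong (allFin k) (λ b → count-step m b q))

    ∑-lexLt-∷ : ∀ a w b q →
      ∑[ u ∈ Wd (length w) ] (ind (lexLt (b ∷ u) (a ∷ w)) * [ state (b ∷ u) ≟ q ]) ≡
      ind (toℕ b <ᵇ toℕ a) * ∑[ u ∈ Wd (length w) ] [ state (b ∷ u) ≟ q ]
      + ind (toℕ b ≡ᵇ toℕ a) * ∑[ u ∈ Wd (length w) ] (ind (lexLt u w) * [ state (b ∷ u) ≟ q ])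
    ∑-lexLt-∷ a w b q = begin
      ∑[ u ∈ us ] (ind (less ∨ (same ∧ lexLt u w)) * [ state (b ∷ u) ≟ q ])
        ≡⟨ ∑-cong us (λ u → cong (_* [ state (b ∷ u) ≟ q ])
                                 (ind-∨-exclusive less same (lexLt u w) (<ᵇ-≡ᵇ-exclusive (toℕ b) (toℕ a)))) ⟩
      ∑[ u ∈ us ] ((ind less + ind same * ind (lexLt u w)) * [ state (b ∷ u) ≟ q ])
        ≡⟨ ∑-cong us (λ u → trans (*-distribʳ-+ _ (ind less) _)
                                  (cong (_+_ (ind less * [ state (b ∷ u) ≟ q ])) (*-assoc (ind same) _ _))) ⟩
      ∑[ u ∈ us ] (ind less * [ state (b ∷ u) ≟ q ] + ind same * (ind (lexLt u w) * [ state (b ∷ u) ≟ q ]))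
        ≡⟨ ∑-distrib-+ us _ _ ⟩
      ∑[ u ∈ us ] (ind less * [ state (b ∷ u) ≟ q ]) + ∑[ u ∈ us ] (ind same * (ind (lexLt u w) * [ state (b ∷ u) ≟ q ]))
        ≡⟨ cong₂ _+_ (∑-*ˡ us (ind less) _) (∑-*ˡ us (ind same) _) ⟩
      ind less * ∑[ u ∈ us ] [ state (b ∷ u) ≟ q ] + ind same * ∑[ u ∈ us ] (ind (lexLt u w) * [ state (b ∷ u) ≟ q ]) ∎
      where
      open ≡-Reasoning
      us = Wd (length w)
      less = toℕ b <ᵇ toℕ a
      same = toℕ b ≡ᵇ toℕ a

    countBelow-∷ : ∀ a w q → countBelow (a ∷ w) q ≡
      ∑[ b ∈ allFin k ] (ind (toℕ b <ᵇ toℕ a) * ∑[ q′ ∈ states ] ([ step b q′ ≟ q ] * count (length w) q′))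
      + ∑[ q′ ∈ states ] ([ step a q′ ≟ q ] * countBelow w q′)
    countBelow-∷ a w q = begin
      ∑[ u ∈ Wd (suc m) ] (ind (lexLt u (a ∷ w)) * [ state u ≟ q ])
        ≡⟨ ∑-wordsOfLength-suc k m _ ⟩
      ∑[ b ∈ bs ] ∑[ u ∈ Wd m ] (ind (lexLt (b ∷ u) (a ∷ w)) * [ state (b ∷ u) ≟ q ])
        ≡⟨ ∑-cong bs (λ b → ∑-lexLt-∷ a w b q) ⟩
      ∑[ b ∈ bs ] (ind (toℕ b <ᵇ toℕ a) * ∑[ u ∈ Wd m ] [ state (b ∷ u) ≟ q ] + ind (toℕ b ≡ᵇ toℕ a) * below b)
        ≡⟨ ∑-distrib-+ bs _ _ ⟩
      ∑[ b ∈ bs ] (ind (toℕ b <ᵇ toℕ a) * ∑[ u ∈ Wd m ] [ state (b ∷ u) ≟ q ]) + ∑[ b ∈ bs ] (ind (toℕ b ≡ᵇ toℕ a) * below b)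
        ≡⟨ cong₂ _+_ (∑-cong bs (λ b → cong (ind (toℕ b <ᵇ toℕ a) *_) (count-step m b q)))
                     (trans (∑-allFin-δ a below) (∑-step m a q (λ u → ind (lexLt u w)))) ⟩
      ∑[ b ∈ bs ] (ind (toℕ b <ᵇ toℕ a) * ∑[ q′ ∈ states ] ([ step b q′ ≟ q ] * count m q′))
      + ∑[ q′ ∈ states ] ([ step a q′ ≟ q ] * countBelow w q′) ∎
      where
      open ≡-Reasoning
      m = length w
      bs = allFin k
      below : Fin k → ℤ
      below b = ∑[ u ∈ Wd m ] (ind (lexLt u w) * [ state (b ∷ u) ≟ q ])

    ∑-upTo-suc : ∀ m (f : ℕ → ℤ) → ∑ (upTo (suc m)) f ≡ ∑ (upTo m) f + f m
    ∑-upTo-suc m f = trans (cong (λ js → ∑ js f) (sym (upTo-∷ʳ m)))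
      (trans (∑-++ (upTo m) (m ∷ []) f) (cong (_+_ (∑ (upTo m) f)) (+-identityʳ (f m))))

    countShorter-suc : ∀ m → countShorter (suc m) ≡ countShorter m + ∑[ q ∈ states ] (ind (accepting q) * count m q)
    countShorter-suc m = trans (∑-upTo-suc m (λ j → ∑[ u ∈ Wd j ] ind (Supp u)))
      (cong (_+_ (countShorter m)) (∑-partition (Wd m) state (ind ∘ accepting)))

    val-Supp : ∀ w → + val Supp w ≡ countShorter (length w) + ∑[ q ∈ states ] (ind (accepting q) * countBelow w q)
    val-Supp w = begin
      + length (filter (T? ∘ below) (wordsUpTo k m))          ≡⟨ length-filter below (wordsUpTo k m) ⟩
      ∑[ u ∈ wordsUpTo k m ] ind (below u)                     ≡⟨ ∑-concatMap Wd (upTo (suc m)) (ind ∘ below) ⟩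
      ∑[ j ∈ upTo (suc m) ] ∑[ u ∈ Wd j ] ind (below u)        ≡⟨ ∑-upTo-suc m (λ j → ∑[ u ∈ Wd j ] ind (below u)) ⟩
      ∑[ j ∈ upTo m ] ∑[ u ∈ Wd j ] ind (below u) + ∑[ u ∈ Wd m ] ind (below u)
        ≡⟨ cong₂ _+_ (∑-cong∈ (upTo m) shorter) (∑-cong∈ (Wd m) same-length) ⟩
      countShorter m + ∑[ u ∈ Wd m ] (ind (lexLt u w) * ind (accepting (state u)))
        ≡⟨ cong (_+_ (countShorter m)) (∑-groupBy (Wd m) state (λ u → ind (lexLt u w)) (ind ∘ accepting)) ⟩
      countShorter m + ∑[ q ∈ states ] (ind (accepting q) * countBelow w q) ∎
      where
      open ≡-Reasoning
      m = length w
      below : Word k → Bool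
      below u = Supp u ∧ radixLt u w
      shorter : ∀ j → j ∈ upTo m → ∑[ u ∈ Wd j ] ind (below u) ≡ ∑[ u ∈ Wd j ] ind (Supp u)
      shorter j j∈ = ∑-cong∈ (Wd j) λ u u∈ → cong ind (begin
        Supp u ∧ ((length u <ᵇ m) ∨ _)  ≡⟨ cong (λ l → Supp u ∧ ((l <ᵇ m) ∨ ((l ≡ᵇ m) ∧ lexLt u w))) (All.lookup (length-wordsOfLength k j) u∈) ⟩
        Supp u ∧ ((j <ᵇ m) ∨ _)         ≡⟨ cong (λ b → Supp u ∧ (b ∨ ((j ≡ᵇ m) ∧ lexLt u w))) (Equivalence.to T-≡ (<⇒<ᵇ (∈-upTo⁻ j∈))) ⟩
        Supp u ∧ true                    ≡⟨ ∧-identityʳ (Supp u) ⟩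
        Supp u ∎)
      same-length : ∀ u → u ∈ Wd m → ind (below u) ≡ ind (lexLt u w) * ind (accepting (state u))
      same-length u u∈ = begin
        ind (Supp u ∧ ((length u <ᵇ m) ∨ ((length u ≡ᵇ m) ∧ lexLt u w)))
          ≡⟨ cong (λ l → ind (Supp u ∧ ((l <ᵇ m) ∨ ((l ≡ᵇ m) ∧ lexLt u w)))) (All.lookup (length-wordsOfLength k m) u∈) ⟩
        ind (Supp u ∧ ((m <ᵇ m) ∨ ((m ≡ᵇ m) ∧ lexLt u w)))
          ≡⟨ cong₂ (λ x y → ind (Supp u ∧ (x ∨ (y ∧ lexLt u w)))) (<ᵇ-irrefl m) (≡ᵇ-refl m) ⟩
        ind (Supp u ∧ lexLt u w)
          ≡⟨ trans (ind-∧ (Supp u) (lexLt u w)) (*-comm (ind (Supp u)) _) ⟩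
        ind (lexLt u w) * ind (accepting (state u)) ∎

module Difference where

  open import Data.Bool using (true; false; if_then_else_)
  open import Data.Fin using (Fin; toℕ)
  open import Data.Integer using (ℤ; +_; 0ℤ; 1ℤ; _+_; _*_; _-_)
  open import Data.Integer.Properties using (+-*-isCommutativeSemiring; pos-+; pos-*; *-zeroˡ; *-identityˡ;
    +-injective; i-j≡0⇒i≡j; +-inverseʳ)
  open import Data.Integer.Tactic.RingSolver using (solve-∀)
  open import Data.List using (List; []; _∷_; _++_; map; allFin; length; cartesianProduct)
  open import Data.List.Membership.Propositional using (_∈_)
  open import Data.List.Membership.Propositional.Properties using (∈-++⁺ˡ; ∈-++⁺ʳ; ∈-map⁺; ∈-allFin; ∈-cartesianProduct⁺)
  open import Data.List.Relation.Unary.Any using (here; there)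
  open import Data.Nat using (ℕ; suc; _<ᵇ_)
  import Data.Nat as ℕ
  import Data.Nat.Properties as ℕ
  open import Data.Product using (_×_; _,_)
  open import Function using (_∘_)
  open import Data.Sum using (inj₁; inj₂)
  open import Relation.Nullary using (Dec; yes; no)
  open import Relation.Binary.PropositionalEquality

  open Sums
  open Sum +-*-isCommutativeSemiring
  module ℕ∑ = Sum ℕ.+-*-isCommutativeSemiring
  open ZeroTest
  open Support
  open Counting

  module Representation {k n : ℕ} (r : Rep k n) where

    open Rep r renaming (row to λ⃗; mu to μ; col to ν)
    open Automaton r
    open Counts r

    states : List State
    states = allBoolVecs n

    data Component : Set where
      entry   : Fin n → Component
      below   : State → Component
      level   : State → Component
      shorter : Component
      one     : Component

    components : List Component
    components = map entry (allFin n) ++ map below states ++ map level states ++ shorter ∷ one ∷ []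

    ∈-components : ∀ c → c ∈ components
    ∈-components (entry i) = ∈-++⁺ˡ (∈-map⁺ entry (∈-allFin i))
    ∈-components (below q) = ∈-++⁺ʳ (map entry (allFin n)) (∈-++⁺ˡ (∈-map⁺ below (∈-allBoolVecs q)))
    ∈-components (level q) = ∈-++⁺ʳ (map entry (allFin n)) (∈-++⁺ʳ (map below states) (∈-++⁺ˡ (∈-map⁺ level (∈-allBoolVecs q))))
    ∈-components shorter   = ∈-++⁺ʳ (map entry (allFin n)) (∈-++⁺ʳ (map below states) (∈-++⁺ʳ (map level states) (here refl)))
    ∈-components one       = ∈-++⁺ʳ (map entry (allFin n)) (∈-++⁺ʳ (map below states) (∈-++⁺ʳ (map level states) (there (here refl))))

    value : Word k → Component → ℤ
    value w (entry i) = + column w i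
    value w (below q) = countBelow w q
    value w (level q) = count (length w) q
    value w shorter   = countShorter (length w)
    value w one       = 1ℤ

    update : Fin k → (Component → ℤ) → Component → ℤ
    update a G (entry i) = ∑[ l ∈ allFin n ] (+ μ a i l * G (entry l))
    update a G (below q) =
      ∑[ b ∈ allFin k ] (ind (toℕ b <ᵇ toℕ a) * ∑[ q′ ∈ states ] ([ step b q′ ≟ q ] * G (level q′)))
      + ∑[ q′ ∈ states ] ([ step a q′ ≟ q ] * G (below q′))
    update a G (level q) = ∑[ b ∈ allFin k ] ∑[ q′ ∈ states ] ([ step b q′ ≟ q ] * G (level q′))
    update a G shorter   = G shorter + ∑[ q ∈ states ] (ind (accepting q) * G (level q))
    update a G one       = G one

    update-linear : ∀ a c → IsLinear (λ G → update a G c)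
    update-linear a (entry i) = ∑-combination-linear (allFin n) (λ l → + μ a i l) (proj-linear ∘ entry)
    update-linear a (below q) =
      +-linear (∑-combination-linear (allFin k) (λ b → ind (toℕ b <ᵇ toℕ a)) (λ b → level-step b q))
               (∑-combination-linear states (λ q′ → [ step a q′ ≟ q ]) (proj-linear ∘ below))
      where
      level-step : ∀ b q → IsLinear (λ G → ∑[ q′ ∈ states ] ([ step b q′ ≟ q ] * G (level q′)))
      level-step b q = ∑-combination-linear states (λ q′ → [ step b q′ ≟ q ]) (proj-linear ∘ level)
    update-linear a (level q) =
      ∑-linear (allFin k) (λ b → ∑-combination-linear states (λ q′ → [ step b q′ ≟ q ]) (proj-linear ∘ level))
    update-linear a shorter   = +-linear (proj-linear shorter) (∑-combination-linear states (ind ∘ accepting) (proj-linear ∘ level))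
    update-linear a one       = proj-linear one

    update-value : ∀ a w c → update a (value w) c ≡ value (a ∷ w) c
    update-value a w (entry i) = sym (trans (cong +_ (column-∷ a w i)) (pos-∑-* (allFin n) (μ a i) (column w)))
    update-value a w (below q) = sym (countBelow-∷ a w q)
    update-value a w (level q) = sym (count-suc (length w) q)
    update-value a w shorter   = sym (countShorter-suc (length w))
    update-value a w one       = refl

    discrepancy : Word k → ℤ
    discrepancy w = + series r w - + suc (val Supp w)

    defect : (Component → ℤ) → ℤ
    defect G = ∑[ i ∈ allFin n ] (+ λ⃗ i * G (entry i)) - G one - G shorter
               - ∑[ q ∈ states ] (ind (accepting q) * G (below q))

    defect-linear : IsLinear defect
    defect-linear = -‿linear (-‿linear (-‿linear (∑-combination-linear (allFin n) (λ i → + λ⃗ i) (proj-linear ∘ entry))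
                                                 (proj-linear one))
                                      (proj-linear shorter))
                            (∑-combination-linear states (ind ∘ accepting) (proj-linear ∘ below))

    defect-value : ∀ w → defect (value w) ≡ discrepancy w
    defect-value w = begin
      X - 1ℤ - countShorter (length w) - Y       ≡⟨ x-1-c-y≡x-[1+[c+y]] X (countShorter (length w)) Y ⟩
      X - (1ℤ + (countShorter (length w) + Y))   ≡⟨ cong₂ (λ x v → x - (1ℤ + v)) (sym (pos-∑-* (allFin n) λ⃗ (column w))) (sym (val-Supp w)) ⟩
      + ℕ∑.∑[ i ∈ allFin n ] (λ⃗ i ℕ.* column w i) - + suc (val Supp w)  ≡⟨ cong (λ x → + x - + suc (val Supp w)) (sym (series-column w)) ⟩
      + series r w - + suc (val Supp w) ∎
      where
      open ≡-Reasoning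
      X = ∑[ i ∈ allFin n ] (+ λ⃗ i * + column w i)
      Y = ∑[ q ∈ states ] (ind (accepting q) * countBelow w q)
      x-1-c-y≡x-[1+[c+y]] : ∀ x c y → x - 1ℤ - c - y ≡ x - (1ℤ + (c + y))
      x-1-c-y≡x-[1+[c+y]] = solve-∀

    Index : Set
    Index = State × Component

    indices : List Index
    indices = cartesianProduct states components

    ∈-indices : ∀ i → i ∈ indices
    ∈-indices (q , c) = ∈-cartesianProduct⁺ (∈-allBoolVecs q) (∈-components c)

    -- Only the block of the automaton's current state is non-zero, so restricting to Supp becomes linear.
    vector : Word k → Index → ℤ
    vector w (q , c) = [ state w ≟ q ] * value w c

    transition : Fin k → (Index → ℤ) → Index → ℤ
    transition a F (q , c) = ∑[ q′ ∈ states ] ([ step a q′ ≟ q ] * update a (λ c′ → F (q′ , c′)) c)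

    transition-linear : ∀ a i → IsLinear (λ F → transition a F i)
    transition-linear a (q , c) = ∑-combination-linear states (λ q′ → [ step a q′ ≟ q ])
                                    (λ q′ → reindex-linear (q′ ,_) (update-linear a c))

    acceptedDefect : (Index → ℤ) → ℤ
    acceptedDefect F = ∑[ q ∈ states ] (ind (accepting q) * defect (λ c → F (q , c)))

    acceptedDefect-linear : IsLinear acceptedDefect
    acceptedDefect-linear = ∑-combination-linear states (ind ∘ accepting) (λ q → reindex-linear (q ,_) defect-linear)

    transition-vector : ∀ a w i → transition a (vector w) i ≡ vector (a ∷ w) i
    transition-vector a w (q , c) = begin
      ∑[ q′ ∈ states ] ([ step a q′ ≟ q ] * update a (λ c′ → [ state w ≟ q′ ] * value w c′) c)
        ≡⟨ ∑-cong states (λ q′ → cong ([ step a q′ ≟ q ] *_) (*-hom (update-linear a c) [ state w ≟ q′ ] (value w))) ⟩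
      ∑[ q′ ∈ states ] ([ step a q′ ≟ q ] * ([ state w ≟ q′ ] * update a (value w) c))
        ≡⟨ ∑-cong states (λ q′ → *-left-comm [ step a q′ ≟ q ] [ state w ≟ q′ ] _) ⟩
      ∑[ q′ ∈ states ] ([ state w ≟ q′ ] * ([ step a q′ ≟ q ] * update a (value w) c))
        ≡⟨ ∑-select (state w) (λ q′ → [ step a q′ ≟ q ] * update a (value w) c) ⟩
      [ step a (state w) ≟ q ] * update a (value w) c
        ≡⟨ cong₂ (λ p x → [ p ≟ q ] * x) (sym (state-∷ a w)) (update-value a w c) ⟩
      [ state (a ∷ w) ≟ q ] * value (a ∷ w) c ∎
      where
      open ≡-Reasoning
      open IsLinear

    acceptedDefect-vector : ∀ w → acceptedDefect (vector w) ≡ ind (Supp w) * discrepancy w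
    acceptedDefect-vector w = begin
      ∑[ q ∈ states ] (ind (accepting q) * defect (λ c → [ state w ≟ q ] * value w c))
        ≡⟨ ∑-cong states (λ q → cong (ind (accepting q) *_) (*-hom defect-linear [ state w ≟ q ] (value w))) ⟩
      ∑[ q ∈ states ] (ind (accepting q) * ([ state w ≟ q ] * defect (value w)))
        ≡⟨ ∑-cong states (λ q → *-left-comm (ind (accepting q)) [ state w ≟ q ] _) ⟩
      ∑[ q ∈ states ] ([ state w ≟ q ] * (ind (accepting q) * defect (value w)))
        ≡⟨ ∑-select (state w) (λ q → ind (accepting q) * defect (value w)) ⟩
      ind (Supp w) * defect (value w)
        ≡⟨ cong (ind (Supp w) *_) (defect-value w) ⟩
      ind (Supp w) * discrepancy w ∎
      where
      open ≡-Reasoning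
      open IsLinear

    open Decide indices ∈-indices transition transition-linear acceptedDefect acceptedDefect-linear (vector [])
      using (run; Outcome; decide)

    run-vector : ∀ w i → run w (vector []) i ≡ vector w i
    run-vector []      i = refl
    run-vector (a ∷ w) i = trans (IsLinear.≗-cong (transition-linear a i) (run-vector w)) (transition-vector a w i)

    defect-run : ∀ w → acceptedDefect (run w (vector [])) ≡ ind (Supp w) * discrepancy w
    defect-run w = trans (IsLinear.≗-cong acceptedDefect-linear (run-vector w)) (acceptedDefect-vector w)

    enumSeries-Supp : ∀ w b → Supp w ≡ b → enumSeries Supp w ≡ (if b then suc (val Supp w) else 0)
    enumSeries-Supp w _ e = cong (λ b → if b then suc (val Supp w) else 0) e

    series-outside : ∀ w → Supp w ≡ false → series r w ≡ 0
    series-outside w e = positive-false (series r w) (trans (positive-series w) e)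

    matches⇒no-defect : ∀ w → series r w ≡ enumSeries Supp w → ind (Supp w) * discrepancy w ≡ 0ℤ
    matches⇒no-defect w matches = by-membership (Supp w) refl
      where
      by-membership : ∀ b → Supp w ≡ b → ind b * discrepancy w ≡ 0ℤ
      by-membership false _ = *-zeroˡ (discrepancy w)
      by-membership true  e = begin
        1ℤ * discrepancy w                          ≡⟨ *-identityˡ (discrepancy w) ⟩
        + series r w - + suc (val Supp w)           ≡⟨ cong (λ x → + x - + suc (val Supp w)) (trans matches (enumSeries-Supp w true e)) ⟩
        + suc (val Supp w) - + suc (val Supp w)     ≡⟨ +-inverseʳ (+ suc (val Supp w)) ⟩
        0ℤ ∎
        where open ≡-Reasoning

    no-defect⇒matches : ∀ w → ind (Supp w) * discrepancy w ≡ 0ℤ → series r w ≡ enumSeries Supp w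
    no-defect⇒matches w no-defect = by-membership (Supp w) refl
      where
      by-membership : ∀ b → Supp w ≡ b → series r w ≡ enumSeries Supp w
      by-membership false e = trans (series-outside w e) (sym (enumSeries-Supp w false e))
      by-membership true  e = trans (+-injective (i-j≡0⇒i≡j (+ series r w) (+ suc (val Supp w)) discrepancy≡0))
                                    (sym (enumSeries-Supp w true e))
        where
        discrepancy≡0 : discrepancy w ≡ 0ℤ
        discrepancy≡0 = trans (sym (*-identityˡ (discrepancy w))) (trans (cong (λ b → ind b * discrepancy w) (sym e)) no-defect)

    decide-matches : Dec (∀ w → series r w ≡ enumSeries Supp w)
    decide-matches = from-outcome decide
      where
      from-outcome : Outcome → Dec (∀ w → series r w ≡ enumSeries Supp w)
      from-outcome (inj₁ vanishes)       = yes λ w → no-defect⇒matches w (trans (sym (defect-run w)) (vanishes w))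
      from-outcome (inj₂ (w , defect≢0)) = no λ matches → defect≢0 (trans (defect-run w) (matches⇒no-defect w (matches w)))

module Infinitude where

  open import Data.Bool using (Bool; true; false)
  open import Data.Empty using (⊥-elim)
  open import Data.Fin using (Fin; toℕ; funToFin; finToFun)
  open import Data.Fin.Properties using (pigeonhole; finToFun-funToFin; toℕ<n)
  open import Data.Integer using (ℤ; +_; _*_)
  import Data.Integer.Properties as ℤ
  open import Data.List using (List; []; _∷_; _++_; map; allFin; length; concat; concatMap; replicate; take; drop; upTo)
  open import Data.List.Properties using (++-assoc; take++drop≡id; drop-drop; length-take; length-drop; length-++; length-++-≤ˡ; length-++-≤ʳ)
  open import Data.List.Membership.Propositional using (_∈_; _∉_; lose; find)
  open import Data.List.Membership.Propositional.Properties using (∈-concat⁺′; ∈-map⁺; ∈-allFin; ∈-upTo⁺)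
  open import Data.List.Relation.Unary.All as All using ()
  open import Data.List.Relation.Unary.Any using (Any; here; there; any?)
  open import Data.Nat using (ℕ; zero; suc; _∸_; _^_; _≤_; _<_; z≤n)
  import Data.Nat.Properties as ℕ
  open import Data.Nat.Properties
    using (≤-trans; <-irrefl; n<1+n; <⇒≤; ≤-pred; +-mono-≤; m≤m+n; m≤n+m; m+[n∸m]≡n; m≤n⇒m⊓n≡m; ∸-monoˡ-≤;
           m<n⇒0<n∸m; m∸[m∸n]≡n; ≮⇒≥; _<?_)
  open import Data.Product using (∃-syntax; _×_; _,_; proj₁; proj₂)
  open import Data.Sum using (inj₁; inj₂)
  open import Data.Vec using (lookup; tabulate)
  open import Data.Vec.Properties using (tabulate∘lookup; tabulate-cong)
  open import Function using (_∘_)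
  open import Relation.Binary.PropositionalEquality
  open import Relation.Nullary using (Dec; yes; no)
  import Relation.Nullary.Decidable as Dec

  open ZeroTest
  open Sums
  open Support
  open Counting using (length-wordsOfLength)

  module Pumping {k n : ℕ} (r : Rep k n) where

    open Automaton r
    open Sum ℕ.+-*-isCommutativeSemiring using (∑)

    bit : Bool → Fin 2
    bit false = Fin.zero
    bit true  = Fin.suc Fin.zero

    bit-injective : ∀ {a b} → bit a ≡ bit b → a ≡ b
    bit-injective {false} {false} _ = refl
    bit-injective {true}  {true}  _ = refl

    encode : State → Fin (2 ^ n)
    encode p = funToFin (bit ∘ lookup p)

    encode-injective : ∀ {p q} → encode p ≡ encode q → p ≡ q
    encode-injective {p} {q} e = begin
      p                   ≡⟨ sym (tabulate∘lookup p) ⟩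
      tabulate (lookup p) ≡⟨ tabulate-cong (λ i → bit-injective (same-bits i)) ⟩
      tabulate (lookup q) ≡⟨ tabulate∘lookup q ⟩
      q                   ∎
      where
      open ≡-Reasoning
      same-bits : ∀ i → bit (lookup p i) ≡ bit (lookup q i)
      same-bits i = trans (sym (finToFun-funToFin (bit ∘ lookup p) i))
                          (trans (cong (λ c → finToFun c i) e) (finToFun-funToFin (bit ∘ lookup q) i))

    state-++ : ∀ u {v v′} → state v ≡ state v′ → state (u ++ v) ≡ state (u ++ v′)
    state-++ []      e = e
    state-++ (a ∷ u) {v} {v′} e =
      trans (state-∷ a (u ++ v)) (trans (cong (step a) (state-++ u e)) (sym (state-∷ a (u ++ v′))))

    power : Word k → ℕ → Word k
    power p t = concat (replicate t p)

    state-power : ∀ p y → state (p ++ y) ≡ state y → ∀ t → state (power p t ++ y) ≡ state y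
    state-power p y e zero    = refl
    state-power p y e (suc t) =
      trans (cong state (++-assoc p (power p t) y)) (trans (state-++ p (state-power p y e t)) e)

    length-power : ∀ p → 1 ≤ length p → ∀ t → t ≤ length (power p t)
    length-power p 1≤p zero    = z≤n
    length-power p 1≤p (suc t) = subst (suc t ≤_) (sym (length-++ p)) (+-mono-≤ 1≤p (length-power p 1≤p t))

    record Loop (w : Word k) : Set where
      field
        prefix cycle suffix : Word k
        split       : w ≡ prefix ++ cycle ++ suffix
        nonempty    : 1 ≤ length cycle
        cycle-state : state (cycle ++ suffix) ≡ state suffix

    -- Among the 2 ^ n + 1 suffixes of w of length ≥ |w| − 2 ^ n, two reach the same state.
    loop : ∀ w → 2 ^ n ≤ length w → Loop w
    loop w N≤w = record { prefix = take i w ; cycle = p ; suffix = drop j w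
                        ; split = w≡ ; nonempty = 1≤p ; cycle-state = loop-state }
      where
      suffix-state : Fin (suc (2 ^ n)) → Fin (2 ^ n)
      suffix-state i = encode (state (drop (toℕ i) w))
      collision = pigeonhole (n<1+n (2 ^ n)) suffix-state
      i = toℕ (proj₁ collision)
      j = toℕ (proj₁ (proj₂ collision))
      i<j : i < j
      i<j = proj₁ (proj₂ (proj₂ collision))
      d = j ∸ i
      p = take d (drop i w)
      drop-d : drop d (drop i w) ≡ drop j w
      drop-d = trans (drop-drop i d w) (cong (λ m → drop m w) (m+[n∸m]≡n (<⇒≤ i<j)))
      p++y : p ++ drop j w ≡ drop i w
      p++y = trans (cong (p ++_) (sym drop-d)) (take++drop≡id d (drop i w))
      w≡ : w ≡ take i w ++ p ++ drop j w
      w≡ = sym (trans (cong (take i w ++_) p++y) (take++drop≡id i w))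
      d≤ : d ≤ length (drop i w)
      d≤ = subst (d ≤_) (sym (length-drop i w)) (∸-monoˡ-≤ i (≤-trans (≤-pred (toℕ<n (proj₁ (proj₂ collision)))) N≤w))
      1≤p : 1 ≤ length p
      1≤p = subst (1 ≤_) (sym (trans (length-take d (drop i w)) (m≤n⇒m⊓n≡m d≤))) (m<n⇒0<n∸m i<j)
      loop-state : state (p ++ drop j w) ≡ state (drop j w)
      loop-state = trans (cong state p++y) (encode-injective (proj₂ (proj₂ (proj₂ collision))))

    ∑length : List (Word k) → ℕ
    ∑length ws = ∑ ws length

    length≤∑length : ∀ {u} ws → u ∈ ws → length u ≤ ∑length ws
    length≤∑length (u ∷ ws) (here refl) = m≤m+n (length u) (∑length ws)
    length≤∑length (v ∷ ws) (there u∈) = ≤-trans (length≤∑length ws u∈) (m≤n+m (∑length ws) (length v))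

    pump : ∀ w → Supp w ≡ true → 2 ^ n ≤ length w → Infinite Supp
    pump w w∈ N≤w ws = pumped (suc (∑length ws)) , pumped∈ (suc (∑length ws)) , pumped∉
      where
      open Loop (loop w N≤w) renaming (prefix to x; cycle to p; suffix to y)
      pumped : ℕ → Word k
      pumped t = x ++ power p t ++ y
      pumped∈ : ∀ t → Supp (pumped t) ≡ true
      pumped∈ t = trans (cong accepting (state-++ x (trans (state-power p y cycle-state t) (sym cycle-state))))
                        (trans (cong Supp (sym split)) w∈)
      long : ∀ t → t ≤ length (pumped t)
      long t = ≤-trans (length-power p nonempty t) (≤-trans (length-++-≤ˡ (power p t)) (length-++-≤ʳ (power p t ++ y) {x}))
      pumped∉ : pumped (suc (∑length ws)) ∉ ws
      pumped∉ m = <-irrefl refl (≤-trans (long (suc (∑length ws))) (length≤∑length ws m))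

  module Coreachability {k n : ℕ} (r : Rep k n) where

    open Rep r renaming (row to λ⃗; mu to μ; col to ν)
    open Automaton r
    open Sum ℤ.+-*-isCommutativeSemiring

    act : Fin k → (Fin n → ℤ) → Fin n → ℤ
    act a v i = ∑[ l ∈ allFin n ] (+ μ a i l * v l)

    weight : (Fin n → ℤ) → ℤ
    weight v = ∑[ i ∈ allFin n ] (+ λ⃗ i * v i)

    weight-linear : IsLinear weight
    weight-linear = ∑-combination-linear (allFin n) (λ i → + λ⃗ i) proj-linear

    module FromSuffix (y : Word k) =
      Decide (allFin n) ∈-allFin act (λ a i → ∑-combination-linear (allFin n) (λ l → + μ a i l) proj-linear)
             weight weight-linear (λ i → + column y i)

    run-column : ∀ y z i → FromSuffix.run y z (λ i → + column y i) i ≡ + column (z ++ y) i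
    run-column y []      i = refl
    run-column y (a ∷ z) i = trans (∑-cong (allFin n) (λ l → cong (+ μ a i l *_) (run-column y z l)))
                                   (sym (trans (cong +_ (column-∷ a (z ++ y) i)) (pos-∑-* (allFin n) (μ a i) (column (z ++ y)))))

    weight-column : ∀ w → weight (λ i → + column w i) ≡ + series r w
    weight-column w = sym (trans (cong +_ (series-column w)) (pos-∑-* (allFin n) λ⃗ (column w)))

    decide-coreachable : ∀ y → Dec (∃[ z ] series r (z ++ y) ≢ 0)
    decide-coreachable y = from-outcome (FromSuffix.decide y)
      where
      series≡weight : ∀ z → + series r (z ++ y) ≡ weight (FromSuffix.run y z (λ i → + column y i))
      series≡weight z = trans (sym (weight-column (z ++ y))) (IsLinear.≗-cong weight-linear (λ i → sym (run-column y z i)))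
      from-outcome : FromSuffix.Outcome y → Dec (∃[ z ] series r (z ++ y) ≢ 0)
      from-outcome (inj₁ vanishes)  = no λ (z , s≢0) → s≢0 (ℤ.+-injective (trans (series≡weight z) (vanishes z)))
      from-outcome (inj₂ (z , w≢0)) = yes (z , λ s≡0 → w≢0 (trans (sym (series≡weight z)) (cong +_ s≡0)))

  module Finiteness {k n : ℕ} (r : Rep k n) where

    open Automaton r
    open Pumping r
    open Coreachability r

    ∈-wordsOfLength : ∀ (u : Word k) → u ∈ wordsOfLength k (length u)
    ∈-wordsOfLength []      = here refl
    ∈-wordsOfLength (a ∷ u) = ∈-concat⁺′ (∈-map⁺ (a ∷_) (∈-wordsOfLength u))
                                         (∈-map⁺ (λ a → map (a ∷_) (wordsOfLength k (length u))) (∈-allFin a))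

    shortWords : List (Word k)
    shortWords = concatMap (wordsOfLength k) (upTo (2 ^ n))

    ∈-shortWords : ∀ u → length u < 2 ^ n → u ∈ shortWords
    ∈-shortWords u short = ∈-concat⁺′ (∈-wordsOfLength u) (∈-map⁺ (wordsOfLength k) (∈-upTo⁺ short))

    long-member : Infinite Supp → ∃[ w ] (Supp w ≡ true × 2 ^ n ≤ length w)
    long-member infinite with infinite shortWords
    ... | w , w∈ , w∉ with length w <? 2 ^ n
    ...   | yes short = ⊥-elim (w∉ (∈-shortWords w short))
    ...   | no  long  = w , w∈ , ≮⇒≥ long

    Coreachable : Word k → Set
    Coreachable y = ∃[ z ] series r (z ++ y) ≢ 0

    infinite⇒coreachable : Infinite Supp → Any Coreachable (wordsOfLength k (2 ^ n))
    infinite⇒coreachable infinite = lose y∈ (take d w , series≢0)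
      where
      w = proj₁ (long-member infinite)
      d = length w ∸ 2 ^ n
      y = drop d w
      length-y : length y ≡ 2 ^ n
      length-y = trans (length-drop d w) (m∸[m∸n]≡n (proj₂ (proj₂ (long-member infinite))))
      y∈ : y ∈ wordsOfLength k (2 ^ n)
      y∈ = subst (λ m → y ∈ wordsOfLength k m) length-y (∈-wordsOfLength y)
      series≢0 : series r (take d w ++ y) ≢ 0
      series≢0 = subst (λ u → series r u ≢ 0) (sym (take++drop≡id d w))
                       (Supp⇒series≢0 w (proj₁ (proj₂ (long-member infinite))))

    coreachable⇒infinite : Any Coreachable (wordsOfLength k (2 ^ n)) → Infinite Supp
    coreachable⇒infinite any with find any
    ... | y , y∈ , z , series≢0 = pump (z ++ y) (series≢0⇒Supp (z ++ y) series≢0)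
      (subst (_≤ length (z ++ y)) (All.lookup (length-wordsOfLength k (2 ^ n)) y∈)
             (subst (length y ≤_) (sym (length-++ z)) (m≤n+m (length y) (length z))))

    decide-infinite : Dec (Infinite Supp)
    decide-infinite = Dec.map′ coreachable⇒infinite infinite⇒coreachable
                               (any? decide-coreachable (wordsOfLength k (2 ^ n)))

open Support
open Difference
open Infinitude

positive-enumSeries : ∀ {k} (L : Language k) w → positive (enumSeries L w) ≡ L w
positive-enumSeries L w with L w
... | true  = refl
... | false = refl

enumSeries-cong : ∀ {k} {L L′ : Language k} → (∀ u → L u ≡ L′ u) → ∀ w → enumSeries L w ≡ enumSeries L′ w
enumSeries-cong {k} {L} {L′} e w = cong₂ (λ b v → if b then suc v else 0) (e w)
  (cong length (filter-≐ (λ u → T? (L u ∧ radixLt u w)) (λ u → T? (L′ u ∧ radixLt u w)) (to , from)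
                         (wordsUpTo k (length w))))
  where
  to : ∀ {u} → T (L u ∧ radixLt u w) → T (L′ u ∧ radixLt u w)
  to {u} = subst (λ b → T (b ∧ radixLt u w)) (e u)
  from : ∀ {u} → T (L′ u ∧ radixLt u w) → T (L u ∧ radixLt u w)
  from {u} = subst (λ b → T (b ∧ radixLt u w)) (sym (e u))

Infinite-cong : ∀ {k} {L L′ : Language k} → (∀ u → L u ≡ L′ u) → Infinite L → Infinite L′
Infinite-cong e infinite ws with infinite ws
... | w , w∈ , w∉ = w , trans (sym (e w)) w∈ , w∉

module _ {k n : ℕ} (r : Rep k n) where

  open Automaton r

  language-is-Supp : ∀ {L} → (∀ w → series r w ≡ enumSeries L w) → ∀ u → L u ≡ Supp u
  language-is-Supp {L} s≡E u = trans (sym (positive-enumSeries L u)) (trans (cong positive (sym (s≡E u))) (positive-series u))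

  isEnumeratingSeries⇔ : (Infinite Supp × (∀ w → series r w ≡ enumSeries Supp w)) ⇔ IsEnumeratingSeries (series r)
  isEnumeratingSeries⇔ = mk⇔
    (λ (infinite , s≡E) → Supp , infinite , s≡E)
    (λ (L , infinite , s≡E) → let L≡Supp = language-is-Supp s≡E in
      Infinite-cong L≡Supp infinite , λ w → trans (s≡E w) (enumSeries-cong L≡Supp w))

theorem2 : (k n : ℕ) (r : Rep k n) → Dec (IsEnumeratingSeries (series r))
theorem2 k n r = Dec.map (isEnumeratingSeries⇔ r)
  (Finiteness.decide-infinite r ×-dec Representation.decide-matches r)
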